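{- Let $a,b\in\mathbb{N}$ and let $M$ be a finite multiset of elements of $\mathbb{N}$. Let $\mathcal{L}_{a,M,b}$ be the set of Łukasiewicz paths $P$ whose first up-step is $U_a$, whose last up-step is $U_b$, and whose profile multiset is $M\uplus\{a,b\}$ (with $\{a,b\}$ understood as a multiset). Define $$\tilde{C}_{a,M,b}(q,t)=\sum_{P\in\mathcal{L}_{a,M,b}} q^{\mathrm{area}(P)}\,t^{\mathrm{depth}(P)}.$$ Then $\tilde{C}_{a,M,b}(q,t)=\tilde{C}_{a,M,b}(t,q)$.
   Context: A Łukasiewicz path is a finite lattice path in $\mathbb{Z}^2$ starting at $(0,0)$, using steps of the form $(1,k)$ with $k\in\mathbb{Z}$, $k\ge -1$, such that every point of the path except the final endpoint has nonnegative $y$-coordinate and the last step is $(1,-1)$, ending at height $-1$. Write $D=(1,-1)$ (down-step) and $U_k=(1,k)$ for $k\ge 0$ (up-step of degree $k$). The profile multiset of $P$ is the multiset of degrees of all up-steps of $P$; $\uplus$ denotes multiset union. Write $P=P_1P_2\cdots P_n$ for the steps. Area: $\mathrm{area}(P)$ is the sum, over all up-steps of $P$, of the $y$-coordinate of the starting point of that up-step. Depth: each down-step $P_j=D$ other than the last step goes from some height $h+1$ to $h$ with $h\ge 0$; it is matched with the up-step $P_i=U_k$ ($k>0$) with the largest index $i<j$ whose starting height $y$ satisfies $y\le h<y+k$ (equivalently, the first up-step of positive degree hit in its interior by the horizontal ray drawn leftwards from the midpoint of $P_j$). Each up-step $U_k$ is then matched with exactly $k$ down-steps $P_{j_1},\dots,P_{j_k}$,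 $j_1<\dots<j_k$, and $P_{j_\ell}$ is called its $\ell$-th matching down-step. Assign values $d_i$ to steps recursively from left to right: if $P_1$ is an up-step, $d_1=0$; if $P_i=D$ is the $\ell$-th matching down-step of the up-step $P_j$, then $d_i=d_j+\ell$; if $P_i$ is an up-step with $i>1$, then $d_i=d_{i-1}$. Then $\mathrm{depth}(P)$ is the sum of $d_i$ over all indices $i$ with $P_i$ an up-step. -}

module Defs where

open import Data.Nat using (ℕ; zero; suc; _+_; _∸_; _≤ᵇ_; _<ᵇ_; _≟_)
open import Data.Nat.Properties using (≤-decTotalOrder)
open import Data.Bool using (Bool; true; false; _∧_; if_then_else_; T)
open import Data.Nat.ListAction using (sum)
open import Data.List using (List; []; _∷_; _++_; [_]; map; zip; zipWith; take; length; filter; upTo; head; last)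
open import Data.Maybe using (Maybe; just; nothing)
import Data.Maybe.Properties as MP
open import Data.Product using (Σ; _×_; _,_)
open import Relation.Binary.PropositionalEquality using (_≡_)
import Data.List.Sort as Sort

-- Steps of a Łukasiewicz path: D = (1,-1), U k = (1,k) with k ≥ 0.
data Step : Set where
  D : Step
  U : ℕ → Step

isUp : Step → Bool
isUp D     = false
isUp (U _) = true

-- Łukasiewicz condition, starting from current height h ≥ 0:
-- the path is nonempty, every point except the final endpoint has
-- height ≥ 0, and the last step is D, going from height 0 to -1.
isLuk : ℕ → List Step → Bool
isLuk h           []            = false
isLuk zero        (D ∷ [])      = true
isLuk zero        (D ∷ _ ∷ _)   = false
isLuk (suc h)     (D ∷ s)       = isLuk h s
isLuk h           (U k ∷ s)     = isLuk (h + k) s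

Lukasiewicz : List Step → Set
Lukasiewicz P = T (isLuk 0 P)

-- starting height of each step (heights are ≥ 0 on a Łukasiewicz path,
-- except the endpoint, which is never a starting point)
startHeights : ℕ → List Step → List ℕ
startHeights h []        = []
startHeights h (D ∷ s)   = h ∷ startHeights (h ∸ 1) s
startHeights h (U k ∷ s) = h ∷ startHeights (h + k) s

-- steps annotated with their starting heights (index i = step P_{i+1})
annot : List Step → List (Step × ℕ)
annot P = zip P (startHeights 0 P)

profile : List Step → List ℕ
profile []        = []
profile (D ∷ s)   = profile s
profile (U k ∷ s) = k ∷ profile s

area : List Step → ℕ
area P = sum (map upHeight (annot P))
  where
  upHeight : Step × ℕ → ℕ
  upHeight (D   , y) = 0
  upHeight (U _ , y) = y

lookupM : {A : Set} → List A → ℕ → Maybe A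
lookupM []       _       = nothing
lookupM (x ∷ xs) zero    = just x
lookupM (x ∷ xs) (suc n) = lookupM xs n

lookupD : List ℕ → ℕ → ℕ
lookupD xs i with lookupM xs i
... | just x  = x
... | nothing = 0

lastIdx : {A : Set} → (A → Bool) → List A → Maybe ℕ
lastIdx p []       = nothing
lastIdx p (x ∷ xs) with lastIdx p xs
... | just i  = just (suc i)
... | nothing = if p x then just 0 else nothing

-- an up-step U k starting at height y is hit in its interior by the
-- horizontal ray at level h + 1/2 iff y ≤ h < y + k
covers : ℕ → Step × ℕ → Bool
covers h (D   , y) = false
covers h (U k , y) = (y ≤ᵇ h) ∧ (h <ᵇ y + k)

-- index of the up-step matched with the down-step at index j (going from
-- height h+1 to h, h ≥ 0): the largest index i < j whose up-step covers h.
-- A down-step starting at height 0 is the last step and is unmatched.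
matchOf : List (Step × ℕ) → ℕ → Maybe ℕ
matchOf A j with lookupM A j
... | just (D , suc h) = lastIdx (covers h) (take j A)
... | _                = nothing

-- ℓ such that the down-step at index j is the ℓ-th matching down-step
-- of its matched up-step
ell : List (Step × ℕ) → ℕ → ℕ
ell A j with matchOf A j
... | nothing = 0
... | just i  = length (filter (λ j′ → MP.≡-dec _≟_ (matchOf A j′) (just i)) (upTo (suc j)))

-- value d_j, given the previously computed values acc = d_0 … d_{j-1}
dAt : List (Step × ℕ) → ℕ → List ℕ → ℕ
dAt A j acc with lookupM A j
... | just (U _ , _) = predVal j
  where
  predVal : ℕ → ℕ
  predVal zero    = 0
  predVal (suc j′) = lookupD acc j′
... | just (D , _) with matchOf A j
...   | just i  = lookupD acc i + ell A j
...   | nothing = 0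
dAt A j acc | nothing = 0

dGo : List (Step × ℕ) → ℕ → List ℕ → ℕ → List ℕ
dGo A j acc zero    = acc
dGo A j acc (suc n) = dGo A (suc j) (acc ++ [ dAt A j acc ]) n

dValues : List Step → List ℕ
dValues P = dGo (annot P) 0 [] (length P)

depth : List Step → ℕ
depth P = sum (zipWith (λ s d → if isUp s then d else 0) P (dValues P))

-- multisets of naturals represented by lists; equality as multisets is
-- equality after sorting
open Sort ≤-decTotalOrder using (sort)

InL : ℕ → List ℕ → ℕ → List Step → Set
InL a M b P =
  Lukasiewicz P ×
  head (profile P) ≡ just a ×
  last (profile P) ≡ just b ×
  sort (profile P) ≡ sort (a ∷ b ∷ M)

-- the paths of 𝓛_{a,M,b} with area i and depth j
-- (their number is the coefficient of q^i t^j in C̃_{a,M,b}(q,t))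
Lcoef : ℕ → List ℕ → ℕ → ℕ → ℕ → Set
Lcoef a M b i j = Σ (List Step) λ P → InL a M b P × area P ≡ i × depth P ≡ j

-- A Łukasiewicz path is the preorder word of a plane tree, a node with k + 1 children being read as U_k
-- and a leaf as D.  The height at which the up-step of a node starts is the number of right siblings of
-- the node and of its ancestors, and its value d in the definition of the depth is the number of their
-- left siblings; so mirroring the tree exchanges area and depth and keeps the profile and the first
-- up-step.  It does not keep the last up-step, but only down-steps follow the last up-step, so its degree
-- can be changed freely without changing area or depth.  Among the paths with first up-step U_a and
-- profile {a, 0} ⊎ M, those whose last up-step is U_b with b > 0 therefore form, after setting b to 0,
-- sets of the same kind for a multiset of smaller sum.  Cancelling them from the mirror symmetry of all
-- these (finitely many) paths gives the symmetry for b = 0 by induction on the sum of M, and every b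
-- reduces to b = 0.

module Submission where

open import Defs
open import Data.Nat
open import Data.Nat.Properties
open import Data.Nat.Induction using (<-wellFounded)
open import Data.Nat.ListAction using (sum)
open import Data.Nat.ListAction.Properties using (sum-++; sum-↭)
open import Data.Bool using (Bool; true; false; if_then_else_; T)
open import Data.Bool.Properties using (T-≡; T-irrelevant)
open import Data.Unit using (tt)
open import Data.Empty using (⊥; ⊥-elim)
open import Data.Fin using (Fin; zero; suc)
open import Data.Fin.Properties using (+↔⊎)
open import Data.Fin.Permutation using (↔⇒≡)
open import Data.List
  using (List; []; _∷_; _++_; [_]; _∷ʳ_; map; zip; zipWith; length; foldl; take; drop; filter; upTo;
         reverse; head; last; null; replicate; cartesianProductWith)
import Data.List.Properties as List
open import Data.List.Properties
  using (foldl-∷ʳ; length-++; upTo-∷ʳ; filter-++; ++-assoc; ++-identityʳ; unfold-reverse; length-reverse;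
         reverse-map; reverse-involutive; length-take; length-drop; take++drop≡id)
open import Data.List.Membership.Propositional using (_∈_)
open import Data.List.Membership.Propositional.Properties using (∈-cartesianProductWith⁺; ∈-map⁺; ∈-upTo⁺; ∈-∃++)
open import Data.List.Membership.DecPropositional _≟_ using (_∈?_)
open import Data.List.Relation.Unary.Any using (here; there)
open import Data.List.Relation.Unary.All using (All; []; _∷_)
import Data.List.Relation.Unary.All as All
open import Data.List.Relation.Binary.Permutation.Propositional
  using (_↭_; ↭-refl; ↭-sym; ↭-trans; prep; swap; ↭⇒↭ₛ; module PermutationReasoning)
import Data.List.Relation.Binary.Permutation.Propositional.Properties as ↭
import Data.List.Relation.Binary.Pointwise as Pointwise
import Data.List.Relation.Unary.Sorted.TotalOrder.Properties as Sorted
open import Data.List.Sort ≤-decTotalOrder using (sort; sort-↭; sort-↗)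
open import Data.Maybe using (Maybe; just; nothing; fromMaybe)
import Data.Maybe.Properties as Maybe
open import Data.Product using (Σ; _×_; _,_; proj₁; proj₂)
open import Data.Product.Function.Dependent.Propositional using (Σ-↔)
open import Data.Sum using (_⊎_; inj₁; inj₂)
open import Data.Sum.Function.Propositional using (_⊎-↔_)
open import Function using (id; _∘_)
open import Function.Bundles using (_↔_; mk↔ₛ′; Equivalence)
open import Function.Properties.Inverse using (↔-refl; ↔-sym; ↔-trans)
open import Function.Related.Propositional using (module EquationalReasoning; bijection)
import Induction.WellFounded as WF
import Relation.Binary.Construct.On as On
import Axiom.UniquenessOfIdentityProofs as UIP
open import Relation.Binary.Definitions using (DecidableEquality)
open import Relation.Binary.PropositionalEquality hiding ([_])
open import Relation.Nullary using (Dec; yes; no; ¬_; ¬?; does; contradiction)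
open import Relation.Nullary.Decidable using (True; toWitness; fromWitness; _×-dec_; T?; map′)
open import Relation.Unary using (Decidable)

length-∷ʳ : ∀ {A : Set} (xs : List A) x → length (xs ∷ʳ x) ≡ suc (length xs)
length-∷ʳ xs x = trans (length-++ xs) (+-comm (length xs) 1)

length-zipWith : ∀ {A B C : Set} (f : A → B → C) (xs : List A) (ys : List B) → length xs ≡ length ys →
                 length (zipWith f xs ys) ≡ length xs
length-zipWith f []       []       _  = refl
length-zipWith f (x ∷ xs) (y ∷ ys) eq = cong suc (length-zipWith f xs ys (suc-injective eq))

zipWith-∷ʳ : ∀ {A B C : Set} (f : A → B → C) (xs : List A) (ys : List B) x y → length xs ≡ length ys →
             zipWith f (xs ∷ʳ x) (ys ∷ʳ y) ≡ zipWith f xs ys ∷ʳ f x y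
zipWith-∷ʳ f []       []       x y _  = refl
zipWith-∷ʳ f (a ∷ xs) (b ∷ ys) x y eq = cong (f a b ∷_) (zipWith-∷ʳ f xs ys x y (suc-injective eq))

take-++ˡ : ∀ {A : Set} (xs ys : List A) {j} → j ≤ length xs → take j (xs ++ ys) ≡ take j xs
take-++ˡ xs       ys {zero}  _         = refl
take-++ˡ (x ∷ xs) ys {suc j} (s≤s j≤n) = cong (x ∷_) (take-++ˡ xs ys j≤n)

take-length-++ : ∀ {A : Set} (xs ys : List A) → take (length xs) (xs ++ ys) ≡ xs
take-length-++ []       ys = refl
take-length-++ (x ∷ xs) ys = cong (x ∷_) (take-length-++ xs ys)

drop-length-++ : ∀ {A : Set} (xs ys : List A) → drop (length xs) (xs ++ ys) ≡ ys
drop-length-++ []       ys = refl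
drop-length-++ (x ∷ xs) ys = drop-length-++ xs ys

lookupM-++ˡ : ∀ {A : Set} (xs ys : List A) {j} → j < length xs → lookupM (xs ++ ys) j ≡ lookupM xs j
lookupM-++ˡ (x ∷ xs) ys {zero}  _         = refl
lookupM-++ˡ (x ∷ xs) ys {suc j} (s≤s j<n) = lookupM-++ˡ xs ys j<n

lookupM-∷ʳ : ∀ {A : Set} (xs : List A) x → lookupM (xs ∷ʳ x) (length xs) ≡ just x
lookupM-∷ʳ []       x = refl
lookupM-∷ʳ (y ∷ xs) x = lookupM-∷ʳ xs x

lastIdx-∷ʳ : ∀ {A : Set} (p : A → Bool) xs x →
             lastIdx p (xs ∷ʳ x) ≡ (if p x then just (length xs) else lastIdx p xs)
lastIdx-∷ʳ p [] x with p x
... | true  = refl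
... | false = refl
lastIdx-∷ʳ p (y ∷ xs) x rewrite lastIdx-∷ʳ p xs x with p x
... | true  = refl
... | false with lastIdx p xs
...   | just i  = refl
...   | nothing = refl

lastIdx-< : ∀ {A : Set} (p : A → Bool) xs {i} → lastIdx p xs ≡ just i → i < length xs
lastIdx-< p (x ∷ xs) eq with lastIdx p xs in e
lastIdx-< p (x ∷ xs) refl | just i' = s≤s (lastIdx-< p xs e)
lastIdx-< p (x ∷ xs) eq   | nothing with p x
lastIdx-< p (x ∷ xs) refl | nothing | true = s≤s z≤n

last-∷ʳ : ∀ {A : Set} (xs : List A) x → last (xs ∷ʳ x) ≡ just x
last-∷ʳ []           x = refl
last-∷ʳ (y ∷ [])     x = refl
last-∷ʳ (y ∷ z ∷ xs) x = last-∷ʳ (z ∷ xs) x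

head-∷ʳ : ∀ {A : Set} (xs : List A) x x′ → xs ≢ [] → head (xs ∷ʳ x) ≡ head (xs ∷ʳ x′)
head-∷ʳ []       x x′ xs≢[] = ⊥-elim (xs≢[] refl)
head-∷ʳ (y ∷ xs) x x′ _     = refl

null-++-∷ : ∀ {A : Set} (xs : List A) y ys → null (xs ++ y ∷ ys) ≡ false
null-++-∷ []       y ys = refl
null-++-∷ (x ∷ xs) y ys = refl

last-∈ : ∀ {A : Set} (xs : List A) {b} → last xs ≡ just b → b ∈ xs
last-∈ (x ∷ [])     refl = here refl
last-∈ (x ∷ y ∷ xs) eq   = there (last-∈ (y ∷ xs) eq)

∷ʳ-↭-cancel : ∀ {A : Set} {xs M : List A} {a b} → xs ∷ʳ b ↭ a ∷ b ∷ M → xs ↭ a ∷ M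
∷ʳ-↭-cancel {xs = xs} {M} {a} {b} p = ↭.drop-∷ (begin
  b ∷ xs       ↭⟨ ↭.∷↭∷ʳ b xs ⟩
  xs ∷ʳ b      ↭⟨ p ⟩
  a ∷ b ∷ M    ↭⟨ swap a b ↭-refl ⟩
  b ∷ a ∷ M    ∎)
  where open PermutationReasoning

∷ʳ-↭ : ∀ {A : Set} {xs M : List A} {a} c → xs ↭ a ∷ M → xs ∷ʳ c ↭ a ∷ c ∷ M
∷ʳ-↭ {xs = xs} {M} {a} c p = begin
  xs ∷ʳ c      ↭⟨ ↭.∷↭∷ʳ c xs ⟨
  c ∷ xs       ↭⟨ prep c p ⟩
  c ∷ a ∷ M    ↭⟨ swap c a ↭-refl ⟩
  a ∷ c ∷ M    ∎
  where open PermutationReasoning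

last-∈-tail : ∀ {A : Set} {xs : List A} {a b c N} →
              head xs ≡ just a → xs ↭ a ∷ c ∷ N → last xs ≡ just b → b ∈ c ∷ N
last-∈-tail {xs = x ∷ []}     refl p eq = ⊥-elim (0≢1+n (↭.↭-length (↭.drop-∷ p)))
last-∈-tail {xs = x ∷ y ∷ ys} refl p eq = ↭.∈-resp-↭ (↭.drop-∷ p) (last-∈ (y ∷ ys) eq)

head⇒last : ∀ {A : Set} {xs : List A} {a} → head xs ≡ just a → last xs ≢ nothing
head⇒last {xs = x ∷ []}     _ ()
head⇒last {xs = x ∷ y ∷ ys} _ eq = head⇒last {xs = y ∷ ys} refl eq

≤-sum : ∀ xs → All (_≤ sum xs) xs
≤-sum []       = []
≤-sum (x ∷ xs) = m≤m+n x (sum xs) ∷ All.map (λ y≤ → ≤-trans y≤ (m≤n+m (sum xs) x)) (≤-sum xs)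

sort≡⇒↭ : ∀ {xs ys} → sort xs ≡ sort ys → xs ↭ ys
sort≡⇒↭ {xs} {ys} eq = ↭-trans (↭-sym (sort-↭ xs)) (subst (_↭ ys) (sym eq) (sort-↭ ys))

↭⇒sort≡ : ∀ {xs ys} → xs ↭ ys → sort xs ≡ sort ys
↭⇒sort≡ {xs} {ys} xs↭ys = Pointwise.Pointwise-≡⇒≡ (Sorted.↗↭↗⇒≋ ≤-totalOrder (sort-↗ xs) (sort-↗ ys)
  (↭⇒↭ₛ (↭-trans (sort-↭ xs) (↭-trans xs↭ys (↭-sym (sort-↭ ys))))))

stepHeight : ℕ → Step → ℕ
stepHeight h D     = h ∸ 1
stepHeight h (U k) = h + k

endHeight : ℕ → List Step → ℕ
endHeight = foldl stepHeight

isLuk-U : ∀ h k s → isLuk h (U k ∷ s) ≡ isLuk (h + k) s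
isLuk-U zero    k s = refl
isLuk-U (suc h) k s = refl

profile-++ : ∀ xs ys → profile (xs ++ ys) ≡ profile xs ++ profile ys
profile-++ []         ys = refl
profile-++ (D ∷ xs)   ys = profile-++ xs ys
profile-++ (U k ∷ xs) ys = cong (k ∷_) (profile-++ xs ys)

length-startHeights : ∀ h P → length (startHeights h P) ≡ length P
length-startHeights h []        = refl
length-startHeights h (D ∷ P)   = cong suc (length-startHeights (h ∸ 1) P)
length-startHeights h (U k ∷ P) = cong suc (length-startHeights (h + k) P)

startHeights-∷ʳ : ∀ h P x → startHeights h (P ∷ʳ x) ≡ startHeights h P ∷ʳ endHeight h P
startHeights-∷ʳ h []        D     = refl
startHeights-∷ʳ h []        (U k) = refl
startHeights-∷ʳ h (D ∷ P)   x     = cong (h ∷_) (startHeights-∷ʳ (h ∸ 1) P x)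
startHeights-∷ʳ h (U k ∷ P) x     = cong (h ∷_) (startHeights-∷ʳ (h + k) P x)

annot-∷ʳ : ∀ P x → annot (P ∷ʳ x) ≡ annot P ∷ʳ (x , endHeight 0 P)
annot-∷ʳ P x = begin
  zip (P ∷ʳ x) (startHeights 0 (P ∷ʳ x))           ≡⟨ cong (zip (P ∷ʳ x)) (startHeights-∷ʳ 0 P x) ⟩
  zip (P ∷ʳ x) (startHeights 0 P ∷ʳ endHeight 0 P) ≡⟨ zipWith-∷ʳ _,_ P _ x _ (sym (length-startHeights 0 P)) ⟩
  annot P ∷ʳ (x , endHeight 0 P)                    ∎
  where open ≡-Reasoning

length-annot : ∀ P → length (annot P) ≡ length P
length-annot P = length-zipWith _,_ P (startHeights 0 P) (sym (length-startHeights 0 P))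

areaFrom : ℕ → List Step → ℕ
areaFrom h []        = 0
areaFrom h (D ∷ s)   = areaFrom (h ∸ 1) s
areaFrom h (U k ∷ s) = h + areaFrom (h + k) s

-- Defs' summand is local to area, so it is passed in through its defining equations.
area≡areaFrom : ∀ P → area P ≡ areaFrom 0 P
area≡areaFrom P = go _ (λ _ → refl) (λ _ _ → refl) 0 P
  where
  go : ∀ (f : Step × ℕ → ℕ) → (∀ y → f (D , y) ≡ 0) → (∀ k y → f (U k , y) ≡ y) →
       ∀ h P → sum (map f (zip P (startHeights h P))) ≡ areaFrom h P
  go f fD fU h []        = refl
  go f fD fU h (D ∷ P)   = cong₂ _+_ (fD h) (go f fD fU (h ∸ 1) P)
  go f fD fU h (U k ∷ P) = cong₂ _+_ (fU k h) (go f fD fU (h + k) P)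

areaFrom-++ : ∀ h W s → areaFrom h (W ++ s) ≡ areaFrom h W + areaFrom (endHeight h W) s
areaFrom-++ h []        s = refl
areaFrom-++ h (D ∷ W)   s = areaFrom-++ (h ∸ 1) W s
areaFrom-++ h (U k ∷ W) s = trans (cong (h +_) (areaFrom-++ (h + k) W s)) (sym (+-assoc h _ _))

lookupD≡ : ∀ xs i → lookupD xs i ≡ fromMaybe 0 (lookupM xs i)
lookupD≡ xs i with lookupM xs i
... | just x  = refl
... | nothing = refl

lookupD-++ˡ : ∀ xs ys {i} → i < length xs → lookupD (xs ++ ys) i ≡ lookupD xs i
lookupD-++ˡ xs ys {i} i<n = begin
  lookupD (xs ++ ys) i                 ≡⟨ lookupD≡ (xs ++ ys) i ⟩
  fromMaybe 0 (lookupM (xs ++ ys) i)   ≡⟨ cong (fromMaybe 0) (lookupM-++ˡ xs ys i<n) ⟩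
  fromMaybe 0 (lookupM xs i)           ≡⟨ lookupD≡ xs i ⟨
  lookupD xs i                         ∎
  where open ≡-Reasoning

lookupD-∷ʳ : ∀ xs v → lookupD (xs ∷ʳ v) (length xs) ≡ v
lookupD-∷ʳ xs v = trans (lookupD≡ (xs ∷ʳ v) (length xs)) (cong (fromMaybe 0) (lookupM-∷ʳ xs v))

matchAt : Maybe (Step × ℕ) → List (Step × ℕ) → Maybe ℕ
matchAt (just (D , suc h)) A = lastIdx (covers h) A
matchAt _                  A = nothing

matchOf≡ : ∀ A j → matchOf A j ≡ matchAt (lookupM A j) (take j A)
matchOf≡ A j with lookupM A j
... | just (D , suc h) = refl
... | just (D , zero)  = refl
... | just (U k , y)   = refl
... | nothing          = refl

matchOf-++ˡ : ∀ A B {j} → j < length A → matchOf (A ++ B) j ≡ matchOf A j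
matchOf-++ˡ A B {j} j<n = begin
  matchOf (A ++ B) j                          ≡⟨ matchOf≡ (A ++ B) j ⟩
  matchAt (lookupM (A ++ B) j) (take j (A ++ B)) ≡⟨ cong₂ matchAt (lookupM-++ˡ A B j<n) (take-++ˡ A B (<⇒≤ j<n)) ⟩
  matchAt (lookupM A j) (take j A)            ≡⟨ matchOf≡ A j ⟨
  matchOf A j                                 ∎
  where open ≡-Reasoning

matchOf-< : ∀ A j {i} → matchOf A j ≡ just i → i < j
matchOf-< A j eq rewrite matchOf≡ A j with lookupM A j
... | just (D , suc h) = ≤-trans (lastIdx-< (covers h) (take j A) eq) (≤-trans (≤-reflexive (length-take j A)) (m⊓n≤m j _))

indicator : Maybe ℕ → ℕ → ℕ
indicator m i = if does (Maybe.≡-dec _≟_ m (just i)) then 1 else 0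

indicator-≡ : ∀ {m} i → m ≡ just i → indicator m i ≡ 1
indicator-≡ {m} i m≡i with Maybe.≡-dec _≟_ m (just i)
... | yes _ = refl
... | no ¬p = ⊥-elim (¬p m≡i)

indicator-≢ : ∀ {m} i → m ≢ just i → indicator m i ≡ 0
indicator-≢ {m} i m≢i with Maybe.≡-dec _≟_ m (just i)
... | yes p = ⊥-elim (m≢i p)
... | no _  = refl

matchCount : List (Step × ℕ) → ℕ → ℕ → ℕ
matchCount A i n = length (filter (λ j → Maybe.≡-dec _≟_ (matchOf A j) (just i)) (upTo n))

matchCount-suc : ∀ A i n → matchCount A i (suc n) ≡ matchCount A i n + indicator (matchOf A n) i
matchCount-suc A i n = begin
  length (filter P? (upTo (suc n)))              ≡⟨ cong (length ∘ filter P?) (upTo-∷ʳ n) ⟨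
  length (filter P? (upTo n ∷ʳ n))               ≡⟨ cong length (filter-++ P? (upTo n) [ n ]) ⟩
  length (filter P? (upTo n) ++ filter P? [ n ]) ≡⟨ length-++ (filter P? (upTo n)) ⟩
  matchCount A i n + length (filter P? [ n ])    ≡⟨ cong (matchCount A i n +_) single ⟩
  matchCount A i n + indicator (matchOf A n) i         ∎
  where
  open ≡-Reasoning
  P? : Decidable (λ j → matchOf A j ≡ just i)
  P? j = Maybe.≡-dec _≟_ (matchOf A j) (just i)
  single : length (filter P? [ n ]) ≡ indicator (matchOf A n) i
  single with Maybe.≡-dec _≟_ (matchOf A n) (just i)
  ... | yes _ = refl
  ... | no _  = refl

matchCount-++ˡ : ∀ A B i {n} → n ≤ length A → matchCount (A ++ B) i n ≡ matchCount A i n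
matchCount-++ˡ A B i {zero}  _   = refl
matchCount-++ˡ A B i {suc n} n<l = begin
  matchCount (A ++ B) i (suc n)                     ≡⟨ matchCount-suc (A ++ B) i n ⟩
  matchCount (A ++ B) i n + indicator (matchOf (A ++ B) n) i ≡⟨ cong₂ _+_ (matchCount-++ˡ A B i (<⇒≤ n<l))
                                                                  (cong (λ m → indicator m i) (matchOf-++ˡ A B n<l)) ⟩
  matchCount A i n + indicator (matchOf A n) i            ≡⟨ matchCount-suc A i n ⟨
  matchCount A i (suc n)                            ∎
  where open ≡-Reasoning

matchCount-≤ : ∀ A i {n} → n ≤ suc i → matchCount A i n ≡ 0
matchCount-≤ A i {zero}  _   = refl
matchCount-≤ A i {suc n} n≤i = begin
  matchCount A i (suc n)                 ≡⟨ matchCount-suc A i n ⟩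
  matchCount A i n + indicator (matchOf A n) i ≡⟨ cong₂ _+_ (matchCount-≤ A i (m≤n⇒m≤1+n (≤-pred n≤i)))
                                                      (indicator-≢ i (λ eq → <⇒≱ (matchOf-< A n eq) (≤-pred n≤i))) ⟩
  0                                      ∎
  where open ≡-Reasoning

ellFrom : Maybe ℕ → List (Step × ℕ) → ℕ → ℕ
ellFrom nothing  A j = 0
ellFrom (just i) A j = matchCount A i (suc j)

ell≡ : ∀ A j → ell A j ≡ ellFrom (matchOf A j) A j
ell≡ A j with matchOf A j
... | nothing = refl
... | just i  = refl

ell-++ˡ : ∀ A B {j} → j < length A → ell (A ++ B) j ≡ ell A j
ell-++ˡ A B {j} j<n rewrite ell≡ (A ++ B) j | ell≡ A j | matchOf-++ˡ A B j<n with matchOf A j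
... | nothing = refl
... | just i  = matchCount-++ˡ A B i j<n

prevD : List ℕ → ℕ → ℕ
prevD acc zero    = 0
prevD acc (suc j) = lookupD acc j

dAtFrom : Maybe (Step × ℕ) → Maybe ℕ → ℕ → List ℕ → ℕ → ℕ
dAtFrom (just (U _ , _)) _        l acc j = prevD acc j
dAtFrom (just (D , _))   (just i) l acc j = lookupD acc i + l
dAtFrom _                _        l acc j = 0

-- The inner with of dAt exposes a fresh copy of lookupM A j inside ell A j, hence the repeated rewrite.
dAt≡ : ∀ A j acc → dAt A j acc ≡ dAtFrom (lookupM A j) (matchOf A j) (ell A j) acc j
dAt≡ A j acc with lookupM A j in e
... | nothing = refl
dAt≡ A zero    acc | just (U k , y)   = refl
dAt≡ A (suc j) acc | just (U k , y)   = refl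
dAt≡ A j       acc | just (D , zero)  rewrite e = refl
dAt≡ A j       acc | just (D , suc h) rewrite e with lastIdx (covers h) (take j A) in e′
... | just i  rewrite e | e′ = refl
... | nothing = refl

dAt-++ˡ : ∀ A B {j} acc → j < length A → dAt (A ++ B) j acc ≡ dAt A j acc
dAt-++ˡ A B {j} acc j<n = begin
  dAt (A ++ B) j acc                                                      ≡⟨ dAt≡ (A ++ B) j acc ⟩
  dAtFrom (lookupM (A ++ B) j) (matchOf (A ++ B) j) (ell (A ++ B) j) acc j
    ≡⟨ cong₂ (λ x (y : Maybe ℕ × ℕ) → dAtFrom x (proj₁ y) (proj₂ y) acc j) (lookupM-++ˡ A B j<n)
             (cong₂ _,_ (matchOf-++ˡ A B j<n) (ell-++ˡ A B j<n)) ⟩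
  dAtFrom (lookupM A j) (matchOf A j) (ell A j) acc j                     ≡⟨ dAt≡ A j acc ⟨
  dAt A j acc                                                             ∎
  where open ≡-Reasoning

dGo-suc : ∀ A j acc n → dGo A j acc (suc n) ≡ dGo A j acc n ∷ʳ dAt A (n + j) (dGo A j acc n)
dGo-suc A j acc zero    = refl
dGo-suc A j acc (suc n) rewrite dGo-suc A (suc j) (acc ∷ʳ dAt A j acc) n | +-suc n j = refl

dGo-++ˡ : ∀ A B j acc n → j + n ≤ length A → dGo (A ++ B) j acc n ≡ dGo A j acc n
dGo-++ˡ A B j acc zero    _ = refl
dGo-++ˡ A B j acc (suc n) j+n<l rewrite +-suc j n | dAt-++ˡ A B acc (≤-trans (s≤s (m≤m+n j n)) j+n<l) =
  dGo-++ˡ A B (suc j) (acc ∷ʳ dAt A j acc) n j+n<l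

length-dGo : ∀ A j acc n → length (dGo A j acc n) ≡ length acc + n
length-dGo A j acc zero    = sym (+-identityʳ _)
length-dGo A j acc (suc n) rewrite length-dGo A (suc j) (acc ∷ʳ dAt A j acc) n | length-∷ʳ acc (dAt A j acc) =
  sym (+-suc _ n)

length-dValues : ∀ P → length (dValues P) ≡ length P
length-dValues P = length-dGo (annot P) 0 [] (length P)

newD : List Step → Step → ℕ
newD P x = dAt (annot P ∷ʳ (x , endHeight 0 P)) (length P) (dValues P)

dValues-∷ʳ : ∀ P x → dValues (P ∷ʳ x) ≡ dValues P ∷ʳ newD P x
dValues-∷ʳ P x = begin
  dGo (annot (P ∷ʳ x)) 0 [] (length (P ∷ʳ x))  ≡⟨ cong₂ (λ A n → dGo A 0 [] n) (annot-∷ʳ P x) (length-∷ʳ P x) ⟩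
  dGo A′ 0 [] (suc n)                           ≡⟨ dGo-suc A′ 0 [] n ⟩
  dGo A′ 0 [] n ∷ʳ dAt A′ (n + 0) (dGo A′ 0 [] n) ≡⟨ cong₂ (λ m acc → acc ∷ʳ dAt A′ m acc) (+-identityʳ n) prefix ⟩
  dValues P ∷ʳ newD P x                         ∎
  where
  open ≡-Reasoning
  A′ : List (Step × ℕ)
  A′ = annot P ∷ʳ (x , endHeight 0 P)
  n : ℕ
  n = length P
  prefix : dGo A′ 0 [] n ≡ dValues P
  prefix = dGo-++ˡ (annot P) _ 0 [] n (≤-reflexive (sym (length-annot P)))

upValue : Step → ℕ → ℕ
upValue s d = if isUp s then d else 0

depth-∷ʳ : ∀ P x → depth (P ∷ʳ x) ≡ depth P + upValue x (newD P x)
depth-∷ʳ P x = begin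
  sum (zipWith upValue (P ∷ʳ x) (dValues (P ∷ʳ x)))            ≡⟨ cong (sum ∘ zipWith upValue (P ∷ʳ x)) (dValues-∷ʳ P x) ⟩
  sum (zipWith upValue (P ∷ʳ x) (dValues P ∷ʳ newD P x))       ≡⟨ cong sum (zipWith-∷ʳ upValue P _ x _ (sym (length-dValues P))) ⟩
  sum (zipWith upValue P (dValues P) ∷ʳ upValue x (newD P x))  ≡⟨ sum-++ (zipWith upValue P (dValues P)) _ ⟩
  depth P + (upValue x (newD P x) + 0)                         ≡⟨ cong (depth P +_) (+-identityʳ _) ⟩
  depth P + upValue x (newD P x)                               ∎
  where open ≡-Reasoning

lookupM-annot-∷ʳ : ∀ P z → lookupM (annot P ∷ʳ z) (length P) ≡ just z
lookupM-annot-∷ʳ P z = trans (cong (lookupM (annot P ∷ʳ z)) (sym (length-annot P))) (lookupM-∷ʳ (annot P) z)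

newD-U : ∀ P k → newD P (U k) ≡ prevD (dValues P) (length P)
newD-U P k = trans (dAt≡ A′ (length P) (dValues P))
  (cong (λ m → dAtFrom m (matchOf A′ (length P)) (ell A′ (length P)) (dValues P) (length P)) (lookupM-annot-∷ʳ P _))
  where
    A′ : List (Step × ℕ)
    A′ = annot P ∷ʳ (U k , endHeight 0 P)

matchOf-new-U : ∀ P k → matchOf (annot P ∷ʳ (U k , endHeight 0 P)) (length P) ≡ nothing
matchOf-new-U P k = trans (matchOf≡ A′ (length P)) (cong (λ m → matchAt m (take (length P) A′)) (lookupM-annot-∷ʳ P _))
  where
    A′ : List (Step × ℕ)
    A′ = annot P ∷ʳ (U k , endHeight 0 P)

matchOf-new-D : ∀ P h → endHeight 0 P ≡ suc h →
                matchOf (annot P ∷ʳ (D , endHeight 0 P)) (length P) ≡ lastIdx (covers h) (annot P)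
matchOf-new-D P h eH = begin
  matchOf A′ (length P)                                      ≡⟨ matchOf≡ A′ (length P) ⟩
  matchAt (lookupM A′ (length P)) (take (length P) A′)        ≡⟨ cong₂ matchAt (lookupM-annot-∷ʳ P _) prefix ⟩
  matchAt (just (D , endHeight 0 P)) (annot P)                ≡⟨ cong (λ y → matchAt (just (D , y)) (annot P)) eH ⟩
  lastIdx (covers h) (annot P)                                ∎
  where
  open ≡-Reasoning
  A′ : List (Step × ℕ)
  A′ = annot P ∷ʳ (D , endHeight 0 P)
  prefix : take (length P) A′ ≡ annot P
  prefix = trans (cong (λ n → take n A′) (sym (length-annot P))) (take-length-++ (annot P) [ _ ])

newD-D : ∀ P {i} → matchOf (annot P ∷ʳ (D , endHeight 0 P)) (length P) ≡ just i →
         newD P D ≡ lookupD (dValues P) i + matchCount (annot P ∷ʳ (D , endHeight 0 P)) i (suc (length P))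
newD-D P {i} m≡i = begin
  newD P D                                       ≡⟨ dAt≡ A′ (length P) (dValues P) ⟩
  dAtFrom (lookupM A′ (length P)) (matchOf A′ (length P)) (ell A′ (length P)) (dValues P) (length P)
    ≡⟨ cong₂ (λ m l → dAtFrom m (matchOf A′ (length P)) l (dValues P) (length P)) (lookupM-annot-∷ʳ P _) (ell≡ A′ (length P)) ⟩
  dAtFrom (just (D , _)) (matchOf A′ (length P)) (ellFrom (matchOf A′ (length P)) A′ (length P)) (dValues P) (length P)
    ≡⟨ cong (λ m → dAtFrom (just (D , endHeight 0 P)) m (ellFrom m A′ (length P)) (dValues P) (length P)) m≡i ⟩
  lookupD (dValues P) i + matchCount A′ i (suc (length P)) ∎
  where
  open ≡-Reasoning
  A′ : List (Step × ℕ)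
  A′ = annot P ∷ʳ (D , endHeight 0 P)

-- Depth as a stack machine

covers-inside : ∀ {h k y} → y ≤ h → h < y + k → covers h (U k , y) ≡ true
covers-inside y≤h h<y+k rewrite Equivalence.to T-≡ (≤⇒≤ᵇ y≤h) | Equivalence.to T-≡ (<⇒<ᵇ h<y+k) = refl

covers-below : ∀ {h k y} → h < y → covers h (U k , y) ≡ false
covers-below {h} {k} {y} h<y with y ≤ᵇ h in y≤ᵇh
... | false = refl
... | true  = contradiction (≤ᵇ⇒≤ y h (Equivalence.from T-≡ y≤ᵇh)) (<⇒≱ h<y)

-- The stack holds, for each up-step whose matching down-steps are not all read yet, the value d of its
-- next matching down-step and the number m of those still to come; a down-step pops exhausted entries.
-- The empty stack is only popped by the final down-step.
mutual
  run : List (ℕ × ℕ) → ℕ → List Step → ℕ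
  run st c []        = 0
  run st c (U k ∷ s) = c + run ((suc c , k) ∷ st) c s
  run st c (D ∷ s)   = popRun st s

  popRun : List (ℕ × ℕ) → List Step → ℕ
  popRun []                 s = run [] 0 s
  popRun ((e , zero) ∷ st)  s = popRun st s
  popRun ((e , suc m) ∷ st) s = run ((suc e , m) ∷ st) e s

record OpenUp (A : List (Step × ℕ)) (dv : List ℕ) (n i y k m e : ℕ) : Set where
  field
    at       : lookupM A i ≡ just (U k , y)
    m≤k      : m ≤ k
    next     : e ≡ suc (lookupD dv i + (k ∸ m))
    covering : ∀ h → y ≤ h → h < y + m → lastIdx (covers h) A ≡ just i
    matched  : matchCount A i n ≡ k ∸ m

-- Stack A dv n b H st: st lists the up-steps of a prefix (annotated steps A, values dv, length n) that still
-- await matching down-steps, topmost first, with decreasing indices below b; H is the current height.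
data Stack (A : List (Step × ℕ)) (dv : List ℕ) (n : ℕ) : ℕ → ℕ → List (ℕ × ℕ) → Set where
  []   : ∀ {b} → Stack A dv n b 0 []
  push : ∀ {b H i y k m e st} → i < b → H ≡ y + m → OpenUp A dv n i y k m e →
         Stack A dv n i y st → Stack A dv n b H ((e , m) ∷ st)

OpenUp-∷ʳ : ∀ {A dv n i y k m e} z v → length A ≡ n → length dv ≡ n → i < n →
            (∀ h → h < y + m → covers h z ≡ false) → matchOf (A ∷ʳ z) n ≢ just i →
            OpenUp A dv n i y k m e → OpenUp (A ∷ʳ z) (dv ∷ʳ v) (suc n) i y k m e
OpenUp-∷ʳ {A} {dv} {n} {i} {y} {k} {m} z v lA ldv i<n free unmatched o = record
  { at       = trans (lookupM-++ˡ A [ z ] (subst (i <_) (sym lA) i<n)) at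
  ; m≤k      = m≤k
  ; next     = trans next (cong (λ d → suc (d + _)) (sym (lookupD-++ˡ dv [ v ] (subst (i <_) (sym ldv) i<n))))
  ; covering = λ h y≤h h< → trans (lastIdx-∷ʳ (covers h) A z) (trans (cong (λ b → if b then _ else _) (free h h<))
                                                                       (covering h y≤h h<))
  ; matched  = begin
      matchCount (A ∷ʳ z) i (suc n)                               ≡⟨ matchCount-suc (A ∷ʳ z) i n ⟩
      matchCount (A ∷ʳ z) i n + indicator (matchOf (A ∷ʳ z) n) i  ≡⟨ cong₂ _+_ (matchCount-++ˡ A [ z ] i (≤-reflexive (sym lA)))
                                                                               (indicator-≢ i unmatched) ⟩
      matchCount A i n + 0                                        ≡⟨ +-identityʳ _ ⟩
      matchCount A i n                                            ≡⟨ matched ⟩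
      k ∸ m                                                       ∎
  }
  where
  open OpenUp o
  open ≡-Reasoning

Stack-∷ʳ : ∀ {A dv n b H st} z v → length A ≡ n → length dv ≡ n → b ≤ n →
           (∀ h → h < H → covers h z ≡ false) → (∀ {i} → matchOf (A ∷ʳ z) n ≡ just i → b ≤ i) →
           Stack A dv n b H st → Stack (A ∷ʳ z) (dv ∷ʳ v) (suc n) b H st
Stack-∷ʳ z v lA ldv b≤n free fresh [] = []
Stack-∷ʳ {n = n} z v lA ldv b≤n free fresh (push {i = i} i<b refl o rest) =
  push i<b refl
    (OpenUp-∷ʳ z v lA ldv i<n free (λ eq → <⇒≱ i<b (fresh eq)) o)
    (Stack-∷ʳ z v lA ldv (<⇒≤ i<n) (λ h h<y → free h (≤-trans h<y (m≤m+n _ _)))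
              (λ eq → <⇒≤ (<-≤-trans i<b (fresh eq))) rest)
  where
  i<n : i < n
  i<n = <-≤-trans i<b b≤n

StackOf : List Step → ℕ → ℕ → List (ℕ × ℕ) → Set
StackOf P = Stack (annot P) (dValues P) (length P)

StackOf-∷ʳ : ∀ P x {H st} →
             Stack (annot P ∷ʳ (x , endHeight 0 P)) (dValues P ∷ʳ newD P x) (suc (length P)) (suc (length P)) H st →
             StackOf (P ∷ʳ x) (length (P ∷ʳ x)) H st
StackOf-∷ʳ P x {H} {st} = subst (λ (A , dv , n) → Stack A dv n n H st)
  (sym (cong₂ _,_ (annot-∷ʳ P x) (cong₂ _,_ (dValues-∷ʳ P x) (length-∷ʳ P x))))

prevD-∷ʳ : ∀ P x → prevD (dValues (P ∷ʳ x)) (length (P ∷ʳ x)) ≡ newD P x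
prevD-∷ʳ P x = begin
  prevD (dValues (P ∷ʳ x)) (length (P ∷ʳ x))            ≡⟨ cong₂ prevD (dValues-∷ʳ P x) (length-∷ʳ P x) ⟩
  lookupD (dValues P ∷ʳ newD P x) (length P)            ≡⟨ cong (lookupD (dValues P ∷ʳ newD P x)) (length-dValues P) ⟨
  lookupD (dValues P ∷ʳ newD P x) (length (dValues P))  ≡⟨ lookupD-∷ʳ (dValues P) (newD P x) ⟩
  newD P x                                              ∎
  where open ≡-Reasoning

Stack-push : ∀ P k {st} → StackOf P (length P) (endHeight 0 P) st →
             StackOf (P ∷ʳ U k) (length (P ∷ʳ U k)) (endHeight 0 (P ∷ʳ U k)) ((suc (prevD (dValues P) (length P)) , k) ∷ st)
Stack-push P k {st} stk = StackOf-∷ʳ P (U k)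
  (subst (λ h → Stack A′ dv′ (suc n) (suc n) h ((suc c , k) ∷ st)) (sym (foldl-∷ʳ stepHeight 0 (U k) P))
    (push ≤-refl refl opened
      (Stack-∷ʳ _ _ (length-annot P) (length-dValues P) ≤-refl (λ h → covers-below)
        (λ eq → contradiction (trans (sym (matchOf-new-U P k)) eq) λ ()) stk)))
  where
  n : ℕ
  n = length P
  H : ℕ
  H = endHeight 0 P
  c : ℕ
  c = prevD (dValues P) n
  A′ : List (Step × ℕ)
  A′ = annot P ∷ʳ (U k , H)
  dv′ : List ℕ
  dv′ = dValues P ∷ʳ newD P (U k)
  d≡c : lookupD dv′ n ≡ c
  d≡c = trans (cong (lookupD dv′) (sym (length-dValues P))) (trans (lookupD-∷ʳ (dValues P) _) (newD-U P k))
  opened : OpenUp A′ dv′ (suc n) n H k k (suc c)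
  opened = record
    { at       = lookupM-annot-∷ʳ P _
    ; m≤k      = ≤-refl
    ; next     = cong suc (sym (trans (cong₂ _+_ d≡c (n∸n≡0 k)) (+-identityʳ c)))
    ; covering = λ h H≤h h<H+k → begin
        lastIdx (covers h) A′                                       ≡⟨ lastIdx-∷ʳ (covers h) (annot P) _ ⟩
        (if covers h (U k , H) then just (length (annot P)) else _) ≡⟨ cong (λ b → if b then _ else _) (covers-inside H≤h h<H+k) ⟩
        just (length (annot P))                                     ≡⟨ cong just (length-annot P) ⟩
        just n                                                      ∎
    ; matched  = trans (matchCount-≤ A′ n ≤-refl) (sym (n∸n≡0 k))
    }
    where open ≡-Reasoning

matchOf-pop : ∀ P {i y k m e} → endHeight 0 P ≡ y + suc m → OpenUp (annot P) (dValues P) (length P) i y k (suc m) e →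
              matchOf (annot P ∷ʳ (D , endHeight 0 P)) (length P) ≡ just i
matchOf-pop P {y = y} {m = m} eH o = trans (matchOf-new-D P (y + m) (trans eH (+-suc y m)))
  (OpenUp.covering o (y + m) (m≤m+n y m) (+-monoʳ-< y (n<1+n m)))

OpenUp-pop : ∀ P {i y k m e} → endHeight 0 P ≡ y + suc m → i < length P →
             OpenUp (annot P) (dValues P) (length P) i y k (suc m) e →
             newD P D ≡ e × OpenUp (annot P ∷ʳ (D , endHeight 0 P)) (dValues P ∷ʳ newD P D) (suc (length P)) i y k m (suc e)
OpenUp-pop P {i} {y} {k} {m} {e} eH i<n o = new≡e , record
  { at       = trans (lookupM-++ˡ A _ (subst (i <_) (sym (length-annot P)) i<n)) at
  ; m≤k      = <⇒≤ m≤k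
  ; next     = cong suc (trans (sym new≡e) (trans value
                 (cong (_+ (k ∸ m)) (sym (lookupD-++ˡ (dValues P) _ (subst (i <_) (sym (length-dValues P)) i<n))))))
  ; covering = λ h y≤h h<y+m → trans (lastIdx-∷ʳ (covers h) A _)
                 (covering h y≤h (<-≤-trans h<y+m (+-monoʳ-≤ y (n≤1+n m))))
  ; matched  = count
  }
  where
  open OpenUp o
  n : ℕ
  n = length P
  A A′ : List (Step × ℕ)
  A = annot P
  A′ = annot P ∷ʳ (D , endHeight 0 P)
  matchedHere : matchOf A′ n ≡ just i
  matchedHere = matchOf-pop P eH o
  k∸m : k ∸ m ≡ suc (k ∸ suc m)
  k∸m = +-∸-assoc 1 m≤k
  count : matchCount A′ i (suc n) ≡ k ∸ m
  count = begin
    matchCount A′ i (suc n)                         ≡⟨ matchCount-suc A′ i n ⟩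
    matchCount A′ i n + indicator (matchOf A′ n) i  ≡⟨ cong₂ _+_ (matchCount-++ˡ A _ i (≤-reflexive (sym (length-annot P))))
                                                                 (indicator-≡ i matchedHere) ⟩
    matchCount A i n + 1                            ≡⟨ cong (_+ 1) matched ⟩
    k ∸ suc m + 1                                   ≡⟨ +-comm _ 1 ⟩
    suc (k ∸ suc m)                                 ≡⟨ k∸m ⟨
    k ∸ m                                           ∎
    where open ≡-Reasoning
  value : newD P D ≡ lookupD (dValues P) i + (k ∸ m)
  value = trans (newD-D P matchedHere) (cong (lookupD (dValues P) i +_) count)
  new≡e : newD P D ≡ e
  new≡e = trans value (trans (cong (lookupD (dValues P) i +_) k∸m) (trans (+-suc _ _) (sym next)))

Stack-pop : ∀ P {b e m st h} → endHeight 0 P ≡ suc h → b ≤ length P → StackOf P b (suc h) ((e , suc m) ∷ st) →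
            newD P D ≡ e × StackOf (P ∷ʳ D) (length (P ∷ʳ D)) (endHeight 0 (P ∷ʳ D)) ((suc e , m) ∷ st)
Stack-pop P {e = e} {m} {st} {h} eH b≤n (push {i = i} {y} {k} i<b H≡ o rest) = proj₁ popped , StackOf-∷ʳ P D
  (subst (λ H → Stack _ _ (suc (length P)) (suc (length P)) H ((suc e , m) ∷ st)) (sym height′)
    (push (≤-trans i<n (n≤1+n (length P))) (suc-injective (trans H≡ (+-suc y m))) (proj₂ popped)
      (Stack-∷ʳ _ _ (length-annot P) (length-dValues P) (<⇒≤ i<n) (λ _ _ → refl)
        (λ eq → ≤-reflexive (Maybe.just-injective (trans (sym (matchOf-pop P (trans eH H≡) o)) eq))) rest)))
  where
  i<n : i < length P
  i<n = <-≤-trans i<b b≤n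
  popped : newD P D ≡ e × OpenUp (annot P ∷ʳ (D , endHeight 0 P)) (dValues P ∷ʳ newD P D) (suc (length P)) i y k m (suc e)
  popped = OpenUp-pop P (trans eH H≡) i<n o
  height′ : endHeight 0 (P ∷ʳ D) ≡ h
  height′ = trans (foldl-∷ʳ stepHeight 0 D P) (cong (_∸ 1) eH)

popRun-[] : ∀ st → popRun st [] ≡ 0
popRun-[] []                 = refl
popRun-[] ((e , zero) ∷ st)  = popRun-[] st
popRun-[] ((e , suc m) ∷ st) = refl

mutual
  depth-++ : ∀ s P st c → T (isLuk (endHeight 0 P) s) → prevD (dValues P) (length P) ≡ c →
             StackOf P (length P) (endHeight 0 P) st → depth (P ++ s) ≡ depth P + run st c s
  depth-++ (U k ∷ s) P st c luk refl stk = begin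
    depth (P ++ U k ∷ s)                          ≡⟨ cong depth (++-assoc P [ U k ] s) ⟨
    depth (P ∷ʳ U k ++ s)                         ≡⟨ depth-++ s (P ∷ʳ U k) ((suc c , k) ∷ st) c luk′
                                                               (trans (prevD-∷ʳ P (U k)) (newD-U P k)) (Stack-push P k stk) ⟩
    depth (P ∷ʳ U k) + run ((suc c , k) ∷ st) c s ≡⟨ cong (_+ run ((suc c , k) ∷ st) c s)
                                                          (trans (depth-∷ʳ P (U k)) (cong (depth P +_) (newD-U P k))) ⟩
    depth P + c + run ((suc c , k) ∷ st) c s      ≡⟨ +-assoc (depth P) c _ ⟩
    depth P + run st c (U k ∷ s)                  ∎
    where
    open ≡-Reasoning
    luk′ : T (isLuk (endHeight 0 (P ∷ʳ U k)) s)
    luk′ rewrite foldl-∷ʳ stepHeight 0 (U k) P | sym (isLuk-U (endHeight 0 P) k s) = luk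
  depth-++ (D ∷ s) P st c luk c≡ stk with endHeight 0 P in eH
  depth-++ (D ∷ []) P st c luk c≡ stk | zero = begin
    depth (P ∷ʳ D)              ≡⟨ depth-∷ʳ P D ⟩
    depth P + 0                 ≡⟨ cong (depth P +_) (popRun-[] st) ⟨
    depth P + run st c (D ∷ []) ∎
    where open ≡-Reasoning
  depth-++ (D ∷ s) P st c luk c≡ stk | suc h = depth-pop s P st c h eH luk c≡ ≤-refl stk

  depth-pop : ∀ s P {b} st c h → endHeight 0 P ≡ suc h → T (isLuk h s) → prevD (dValues P) (length P) ≡ c →
              b ≤ length P → StackOf P b (suc h) st → depth (P ++ D ∷ s) ≡ depth P + popRun st s
  depth-pop s P ((e , zero) ∷ st) c h eH luk c≡ b≤n (push i<b H≡y+0 o rest) =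
    depth-pop s P st c h eH luk c≡ (<⇒≤ (<-≤-trans i<b b≤n))
      (subst (λ H → StackOf P _ H st) (trans (sym (+-identityʳ _)) (sym H≡y+0)) rest)
  depth-pop s P ((e , suc m) ∷ st) c h eH luk c≡ b≤n stk with Stack-pop P eH b≤n stk
  ... | new≡e , stk′ = begin
    depth (P ++ D ∷ s)                           ≡⟨ cong depth (++-assoc P [ D ] s) ⟨
    depth (P ∷ʳ D ++ s)                          ≡⟨ depth-++ s (P ∷ʳ D) ((suc e , m) ∷ st) e luk′ (trans (prevD-∷ʳ P D) new≡e) stk′ ⟩
    depth (P ∷ʳ D) + run ((suc e , m) ∷ st) e s  ≡⟨ cong (_+ run ((suc e , m) ∷ st) e s) (trans (depth-∷ʳ P D) (+-identityʳ _)) ⟩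
    depth P + popRun ((e , suc m) ∷ st) s        ∎
    where
    open ≡-Reasoning
    luk′ : T (isLuk (endHeight 0 (P ∷ʳ D)) s)
    luk′ = subst (λ g → T (isLuk g s)) (sym (trans (foldl-∷ʳ stepHeight 0 D P) (cong (_∸ 1) eH))) luk

depth≡run : ∀ P → T (isLuk 0 P) → depth P ≡ run [] 0 P
depth≡run P luk = depth-++ P [] [] 0 luk refl []

-- Plane trees

data Tree : Set where
  node : List Tree → Tree

-- word t s is the preorder word of t followed by s: a node with k + 1 children is read as U k, a leaf as D.
mutual
  word : Tree → List Step → List Step
  word (node [])       s = D ∷ s
  word (node (t ∷ ts)) s = U (length ts) ∷ words (t ∷ ts) s

  words : List Tree → List Step → List Step
  words []       s = s
  words (t ∷ ts) s = word t (words ts s)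

parseForest : ℕ → List Step → List Tree
parseForest h       []        = []
parseForest h       (U k ∷ s) = node (take (suc k) f) ∷ drop (suc k) f
  where
    f : List Tree
    f = parseForest (h + k) s
parseForest zero    (D ∷ s)   = node [] ∷ []
parseForest (suc h) (D ∷ s)   = node [] ∷ parseForest h s

parse : List Step → Tree
parse P = fromMaybe (node []) (head (parseForest 0 P))

mutual
  treeArea : Tree → ℕ → ℕ
  treeArea (node [])       h = 0
  treeArea (node (t ∷ ts)) h = h + forestArea (t ∷ ts) h

  forestArea : List Tree → ℕ → ℕ
  forestArea []       h = 0
  forestArea (t ∷ ts) h = treeArea t (length ts + h) + forestArea ts h

mutual
  treeDepth : Tree → ℕ → ℕ
  treeDepth (node [])       c = 0
  treeDepth (node (t ∷ ts)) c = c + forestDepth (t ∷ ts) c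

  forestDepth : List Tree → ℕ → ℕ
  forestDepth []       c = 0
  forestDepth (t ∷ ts) c = treeDepth t c + forestDepth ts (suc c)

mutual
  treeProfile : Tree → List ℕ
  treeProfile (node [])       = []
  treeProfile (node (t ∷ ts)) = length ts ∷ forestProfile (t ∷ ts)

  forestProfile : List Tree → List ℕ
  forestProfile []       = []
  forestProfile (t ∷ ts) = treeProfile t ++ forestProfile ts

-- Seen from the outside, a tree behaves like a single down-step (plus its own area and depth).
mutual
  isLuk-word : ∀ t h s → isLuk h (word t s) ≡ isLuk h (D ∷ s)
  isLuk-word (node [])       h s = refl
  isLuk-word (node (t ∷ ts)) h s = begin
    isLuk h (U (length ts) ∷ words (t ∷ ts) s)  ≡⟨ isLuk-U h (length ts) _ ⟩
    isLuk (h + length ts) (words (t ∷ ts) s)   ≡⟨ cong (λ g → isLuk g (words (t ∷ ts) s)) (+-comm h (length ts)) ⟩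
    isLuk (length ts + h) (words (t ∷ ts) s)   ≡⟨ isLuk-words t ts h s ⟩
    isLuk h (D ∷ s)                            ∎
    where open ≡-Reasoning

  isLuk-words : ∀ t ts h s → isLuk (length ts + h) (words (t ∷ ts) s) ≡ isLuk h (D ∷ s)
  isLuk-words t []        h s = isLuk-word t h s
  isLuk-words t (t′ ∷ ts) h s = trans (isLuk-word t _ (words (t′ ∷ ts) s)) (isLuk-words t′ ts h s)

mutual
  areaFrom-word : ∀ t h s → areaFrom h (word t s) ≡ treeArea t h + areaFrom h (D ∷ s)
  areaFrom-word (node [])       h s = refl
  areaFrom-word (node (t ∷ ts)) h s = begin
    h + areaFrom (h + length ts) (words (t ∷ ts) s)            ≡⟨ cong (λ g → h + areaFrom g (words (t ∷ ts) s)) (+-comm h (length ts)) ⟩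
    h + areaFrom (length ts + h) (words (t ∷ ts) s)            ≡⟨ cong (h +_) (areaFrom-words t ts h s) ⟩
    h + (forestArea (t ∷ ts) h + areaFrom h (D ∷ s))           ≡⟨ +-assoc h _ _ ⟨
    h + forestArea (t ∷ ts) h + areaFrom h (D ∷ s)             ∎
    where open ≡-Reasoning

  areaFrom-words : ∀ t ts h s → areaFrom (length ts + h) (words (t ∷ ts) s) ≡ forestArea (t ∷ ts) h + areaFrom h (D ∷ s)
  areaFrom-words t []        h s = trans (areaFrom-word t h s) (cong (_+ areaFrom h (D ∷ s)) (sym (+-identityʳ _)))
  areaFrom-words t (t′ ∷ ts) h s =
    trans (areaFrom-word t _ (words (t′ ∷ ts) s))
          (trans (cong (treeArea t _ +_) (areaFrom-words t′ ts h s)) (sym (+-assoc (treeArea t _) _ _)))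

mutual
  run-word : ∀ t st c s → run st c (word t s) ≡ treeDepth t c + run st c (D ∷ s)
  run-word (node [])       st c s = refl
  run-word (node (t ∷ ts)) st c s =
    trans (cong (c +_) (run-words t ts st c s)) (sym (+-assoc c _ _))

  run-words : ∀ t ts st c s →
              run ((suc c , length ts) ∷ st) c (words (t ∷ ts) s) ≡ forestDepth (t ∷ ts) c + run st c (D ∷ s)
  run-words t []        st c s =
    trans (run-word t _ c s) (cong (_+ popRun st s) (sym (+-identityʳ _)))
  run-words t (t′ ∷ ts) st c s =
    trans (run-word t _ c (words (t′ ∷ ts) s))
          (trans (cong (treeDepth t c +_) (run-words t′ ts st (suc c) s)) (sym (+-assoc (treeDepth t c) _ _)))

mutual
  parseForest-word : ∀ t h s → parseForest h (word t s) ≡ t ∷ drop 1 (parseForest h (D ∷ s))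
  parseForest-word (node [])       zero    s = refl
  parseForest-word (node [])       (suc h) s = refl
  parseForest-word (node (t ∷ ts)) h s
    rewrite +-comm h (length ts) | parseForest-words t ts h s
          | take-length-++ (t ∷ ts) (drop 1 (parseForest h (D ∷ s)))
          | drop-length-++ (t ∷ ts) (drop 1 (parseForest h (D ∷ s))) = refl

  parseForest-words : ∀ t ts h s → parseForest (length ts + h) (words (t ∷ ts) s) ≡ (t ∷ ts) ++ drop 1 (parseForest h (D ∷ s))
  parseForest-words t []        h s = parseForest-word t h s
  parseForest-words t (t′ ∷ ts) h s =
    trans (parseForest-word t _ (words (t′ ∷ ts) s)) (cong (t ∷_) (parseForest-words t′ ts h s))

parse-word : ∀ t → parse (word t []) ≡ t
parse-word t = cong (fromMaybe (node []) ∘ head) (parseForest-word t 0 [])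

words-++ : ∀ xs ys s → words (xs ++ ys) s ≡ words xs (words ys s)
words-++ []       ys s = refl
words-++ (x ∷ xs) ys s = cong (word x) (words-++ xs ys s)

length-parseForest : ∀ h P → T (isLuk h P) → length (parseForest h P) ≡ suc h
length-parseForest h (U k ∷ s) luk = begin
  suc (length (drop (suc k) f))    ≡⟨ cong suc (length-drop (suc k) f) ⟩
  suc (length f ∸ suc k)           ≡⟨ cong (λ n → suc (n ∸ suc k)) (length-parseForest (h + k) s luk′) ⟩
  suc (suc (h + k) ∸ suc k)        ≡⟨ cong suc (m+n∸n≡m h k) ⟩
  suc h                            ∎
  where
  open ≡-Reasoning
  f : List Tree
  f = parseForest (h + k) s
  luk′ : T (isLuk (h + k) s)
  luk′ = subst T (isLuk-U h k s) luk
length-parseForest zero    (D ∷ [])    luk = refl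
length-parseForest (suc h) (D ∷ s)     luk = cong suc (length-parseForest h s luk)

words-parseForest : ∀ h P → T (isLuk h P) → words (parseForest h P) [] ≡ P
words-parseForest h (U k ∷ s) luk
  with parseForest (h + k) s | length-parseForest (h + k) s (subst T (isLuk-U h k s) luk)
     | words-parseForest (h + k) s (subst T (isLuk-U h k s) luk)
... | t ∷ f | length≡ | words≡ = cong₂ (λ n r → U n ∷ r) degree (trans children words≡)
  where
  degree : length (take k f) ≡ k
  degree = trans (length-take k f) (m≤n⇒m⊓n≡m (subst (k ≤_) (sym (suc-injective length≡)) (m≤n+m k h)))
  children : word t (words (take k f) (words (drop k f) [])) ≡ word t (words f [])
  children = cong (word t) (trans (sym (words-++ (take k f) (drop k f) [])) (cong (λ g → words g []) (take++drop≡id k f)))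
words-parseForest zero    (D ∷ [])    luk = refl
words-parseForest (suc h) (D ∷ s)     luk = cong (D ∷_) (words-parseForest h s luk)

word-parse : ∀ P → T (isLuk 0 P) → word (parse P) [] ≡ P
word-parse P luk with parseForest 0 P | length-parseForest 0 P luk | words-parseForest 0 P luk
... | t ∷ [] | _ | words≡ = words≡

mutual
  profile-word : ∀ t s → profile (word t s) ≡ treeProfile t ++ profile s
  profile-word (node [])       s = refl
  profile-word (node (t ∷ ts)) s = cong (length ts ∷_) (profile-words (t ∷ ts) s)

  profile-words : ∀ ts s → profile (words ts s) ≡ forestProfile ts ++ profile s
  profile-words []       s = refl
  profile-words (t ∷ ts) s = begin
    profile (word t (words ts s))                     ≡⟨ profile-word t (words ts s) ⟩
    treeProfile t ++ profile (words ts s)             ≡⟨ cong (treeProfile t ++_) (profile-words ts s) ⟩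
    treeProfile t ++ (forestProfile ts ++ profile s)  ≡⟨ ++-assoc (treeProfile t) _ _ ⟨
    forestProfile (t ∷ ts) ++ profile s               ∎
    where open ≡-Reasoning

isLuk-word-[] : ∀ t → T (isLuk 0 (word t []))
isLuk-word-[] t = subst T (sym (isLuk-word t 0 [])) tt

area-word : ∀ t → area (word t []) ≡ treeArea t 0
area-word t = trans (area≡areaFrom (word t [])) (trans (areaFrom-word t 0 []) (+-identityʳ _))

depth-word : ∀ t → depth (word t []) ≡ treeDepth t 0
depth-word t = trans (depth≡run (word t []) (isLuk-word-[] t)) (trans (run-word t [] 0 []) (+-identityʳ _))

profile-word-[] : ∀ t → profile (word t []) ≡ treeProfile t
profile-word-[] t = trans (profile-word t []) (++-identityʳ _)

-- Mirroring

mutual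
  mirror : Tree → Tree
  mirror (node ts) = node (reverse (mirrors ts))

  mirrors : List Tree → List Tree
  mirrors []       = []
  mirrors (t ∷ ts) = mirror t ∷ mirrors ts

mirrors≡map : ∀ ts → mirrors ts ≡ map mirror ts
mirrors≡map []       = refl
mirrors≡map (t ∷ ts) = cong (mirror t ∷_) (mirrors≡map ts)

length-mirrors : ∀ ts → length (mirrors ts) ≡ length ts
length-mirrors []       = refl
length-mirrors (t ∷ ts) = cong suc (length-mirrors ts)

mutual
  mirror-involutive : ∀ t → mirror (mirror t) ≡ t
  mirror-involutive (node ts) = cong node (begin
    reverse (mirrors (reverse (mirrors ts)))  ≡⟨ cong reverse (mirrors≡map (reverse (mirrors ts))) ⟩
    reverse (map mirror (reverse (mirrors ts))) ≡⟨ cong reverse (reverse-map mirror (mirrors ts)) ⟩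
    reverse (reverse (map mirror (mirrors ts))) ≡⟨ reverse-involutive _ ⟩
    map mirror (mirrors ts)                    ≡⟨ mirrors≡map (mirrors ts) ⟨
    mirrors (mirrors ts)                       ≡⟨ mirrors-involutive ts ⟩
    ts                                         ∎)
    where open ≡-Reasoning

  mirrors-involutive : ∀ ts → mirrors (mirrors ts) ≡ ts
  mirrors-involutive []       = refl
  mirrors-involutive (t ∷ ts) = cong₂ _∷_ (mirror-involutive t) (mirrors-involutive ts)

reverse-mirrors-∷ : ∀ t ts → reverse (mirrors (t ∷ ts)) ≡ reverse (mirrors ts) ∷ʳ mirror t
reverse-mirrors-∷ t ts = unfold-reverse (mirror t) (mirrors ts)

treeArea-node-∷ʳ : ∀ xs x h → treeArea (node (xs ∷ʳ x)) h ≡ h + forestArea (xs ∷ʳ x) h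
treeArea-node-∷ʳ []       x h = refl
treeArea-node-∷ʳ (y ∷ xs) x h = refl

forestArea-∷ʳ : ∀ xs x h → forestArea (xs ∷ʳ x) h ≡ forestArea xs (suc h) + treeArea x h
forestArea-∷ʳ []       x h = +-identityʳ _
forestArea-∷ʳ (y ∷ xs) x h = begin
  treeArea y (length (xs ∷ʳ x) + h) + forestArea (xs ∷ʳ x) h          ≡⟨ cong₂ _+_ (cong (treeArea y) height) (forestArea-∷ʳ xs x h) ⟩
  treeArea y (length xs + suc h) + (forestArea xs (suc h) + treeArea x h) ≡⟨ +-assoc (treeArea y _) _ _ ⟨
  forestArea (y ∷ xs) (suc h) + treeArea x h                           ∎
  where
  open ≡-Reasoning
  height : length (xs ∷ʳ x) + h ≡ length xs + suc h
  height = trans (cong (_+ h) (length-∷ʳ xs x)) (sym (+-suc (length xs) h))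

-- Mirroring turns the heights of the children of a node (counted from the right) into their left-sibling counts.
forestArea-mirror : ∀ ts h → forestArea (reverse (mirrors ts)) h ≡ forestDepth ts h
treeArea-mirror : ∀ t h → treeArea (mirror t) h ≡ treeDepth t h

forestArea-mirror []       h = refl
forestArea-mirror (t ∷ ts) h = begin
  forestArea (reverse (mirrors (t ∷ ts))) h                        ≡⟨ cong (λ f → forestArea f h) (reverse-mirrors-∷ t ts) ⟩
  forestArea (reverse (mirrors ts) ∷ʳ mirror t) h                   ≡⟨ forestArea-∷ʳ (reverse (mirrors ts)) (mirror t) h ⟩
  forestArea (reverse (mirrors ts)) (suc h) + treeArea (mirror t) h ≡⟨ cong₂ _+_ (forestArea-mirror ts (suc h)) (treeArea-mirror t h) ⟩
  forestDepth ts (suc h) + treeDepth t h                           ≡⟨ +-comm _ (treeDepth t h) ⟩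
  forestDepth (t ∷ ts) h                                           ∎
  where open ≡-Reasoning

treeArea-mirror (node [])       h = refl
treeArea-mirror (node (t ∷ ts)) h = begin
  treeArea (node (reverse (mirrors (t ∷ ts)))) h        ≡⟨ cong (λ f → treeArea (node f) h) (reverse-mirrors-∷ t ts) ⟩
  treeArea (node (reverse (mirrors ts) ∷ʳ mirror t)) h  ≡⟨ treeArea-node-∷ʳ (reverse (mirrors ts)) (mirror t) h ⟩
  h + forestArea (reverse (mirrors ts) ∷ʳ mirror t) h   ≡⟨ cong (λ f → h + forestArea f h) (reverse-mirrors-∷ t ts) ⟨
  h + forestArea (reverse (mirrors (t ∷ ts))) h         ≡⟨ cong (h +_) (forestArea-mirror (t ∷ ts) h) ⟩
  treeDepth (node (t ∷ ts)) h                           ∎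
  where open ≡-Reasoning

treeDepth-mirror : ∀ t c → treeDepth (mirror t) c ≡ treeArea t c
treeDepth-mirror t c = trans (sym (treeArea-mirror (mirror t) c)) (cong (λ u → treeArea u c) (mirror-involutive t))

treeProfile-node-∷ʳ : ∀ xs x → treeProfile (node (xs ∷ʳ x)) ≡ length xs ∷ forestProfile (xs ∷ʳ x)
treeProfile-node-∷ʳ []       x = refl
treeProfile-node-∷ʳ (y ∷ xs) x = cong (_∷ forestProfile ((y ∷ xs) ∷ʳ x)) (length-∷ʳ xs x)

forestProfile-∷ʳ : ∀ xs x → forestProfile (xs ∷ʳ x) ≡ forestProfile xs ++ treeProfile x
forestProfile-∷ʳ []       x = ++-identityʳ _
forestProfile-∷ʳ (y ∷ xs) x = trans (cong (treeProfile y ++_) (forestProfile-∷ʳ xs x)) (sym (++-assoc (treeProfile y) _ _))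

forestProfile-mirror : ∀ ts → forestProfile (reverse (mirrors ts)) ↭ forestProfile ts
treeProfile-mirror : ∀ t → treeProfile (mirror t) ↭ treeProfile t

forestProfile-mirror []       = ↭-refl
forestProfile-mirror (t ∷ ts) = begin
  forestProfile (reverse (mirrors (t ∷ ts)))                   ≡⟨ cong forestProfile (reverse-mirrors-∷ t ts) ⟩
  forestProfile (reverse (mirrors ts) ∷ʳ mirror t)              ≡⟨ forestProfile-∷ʳ (reverse (mirrors ts)) (mirror t) ⟩
  forestProfile (reverse (mirrors ts)) ++ treeProfile (mirror t) ↭⟨ ↭.++⁺ (forestProfile-mirror ts) (treeProfile-mirror t) ⟩
  forestProfile ts ++ treeProfile t                             ↭⟨ ↭.++-comm (forestProfile ts) (treeProfile t) ⟩
  forestProfile (t ∷ ts)                                        ∎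
  where open PermutationReasoning

treeProfile-mirror (node [])       = ↭-refl
treeProfile-mirror (node (t ∷ ts)) = begin
  treeProfile (node (reverse (mirrors (t ∷ ts))))        ≡⟨ cong (treeProfile ∘ node) (reverse-mirrors-∷ t ts) ⟩
  treeProfile (node (reverse (mirrors ts) ∷ʳ mirror t))  ≡⟨ treeProfile-node-∷ʳ (reverse (mirrors ts)) (mirror t) ⟩
  length (reverse (mirrors ts)) ∷ forestProfile (reverse (mirrors ts) ∷ʳ mirror t)
    ≡⟨ cong₂ _∷_ (trans (length-reverse (mirrors ts)) (length-mirrors ts)) (cong forestProfile (sym (reverse-mirrors-∷ t ts))) ⟩
  length ts ∷ forestProfile (reverse (mirrors (t ∷ ts)))  ↭⟨ prep (length ts) (forestProfile-mirror (t ∷ ts)) ⟩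
  treeProfile (node (t ∷ ts))                            ∎
  where open PermutationReasoning

head-treeProfile-mirror : ∀ t → head (treeProfile (mirror t)) ≡ head (treeProfile t)
head-treeProfile-mirror (node [])       = refl
head-treeProfile-mirror (node (t ∷ ts)) = begin
  head (treeProfile (node (reverse (mirrors (t ∷ ts)))))       ≡⟨ cong (head ∘ treeProfile ∘ node) (reverse-mirrors-∷ t ts) ⟩
  head (treeProfile (node (reverse (mirrors ts) ∷ʳ mirror t))) ≡⟨ cong head (treeProfile-node-∷ʳ (reverse (mirrors ts)) (mirror t)) ⟩
  just (length (reverse (mirrors ts)))                         ≡⟨ cong just (trans (length-reverse (mirrors ts)) (length-mirrors ts)) ⟩
  just (length ts)                                             ∎
  where open ≡-Reasoning

mirrorPath : List Step → List Step
mirrorPath P = word (mirror (parse P)) []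

isLuk-mirrorPath : ∀ P → T (isLuk 0 (mirrorPath P))
isLuk-mirrorPath P = isLuk-word-[] (mirror (parse P))

module _ {P : List Step} (luk : T (isLuk 0 P)) where

  private
    t : Tree
    t = parse P
    P≡ : word t [] ≡ P
    P≡ = word-parse P luk

  mirrorPath-involutive : mirrorPath (mirrorPath P) ≡ P
  mirrorPath-involutive = begin
    word (mirror (parse (word (mirror t) []))) []  ≡⟨ cong (λ u → word (mirror u) []) (parse-word (mirror t)) ⟩
    word (mirror (mirror t)) []                    ≡⟨ cong (λ u → word u []) (mirror-involutive t) ⟩
    word t []                                      ≡⟨ P≡ ⟩
    P                                              ∎
    where open ≡-Reasoning

  area-mirrorPath : area (mirrorPath P) ≡ depth P
  area-mirrorPath = begin
    area (word (mirror t) [])  ≡⟨ area-word (mirror t) ⟩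
    treeArea (mirror t) 0      ≡⟨ treeArea-mirror t 0 ⟩
    treeDepth t 0              ≡⟨ depth-word t ⟨
    depth (word t [])          ≡⟨ cong depth P≡ ⟩
    depth P                    ∎
    where open ≡-Reasoning

  depth-mirrorPath : depth (mirrorPath P) ≡ area P
  depth-mirrorPath = begin
    depth (word (mirror t) [])  ≡⟨ depth-word (mirror t) ⟩
    treeDepth (mirror t) 0      ≡⟨ treeDepth-mirror t 0 ⟩
    treeArea t 0                ≡⟨ area-word t ⟨
    area (word t [])            ≡⟨ cong area P≡ ⟩
    area P                      ∎
    where open ≡-Reasoning

  profile-mirrorPath : profile (mirrorPath P) ↭ profile P
  profile-mirrorPath = begin
    profile (word (mirror t) [])  ≡⟨ profile-word-[] (mirror t) ⟩
    treeProfile (mirror t)        ↭⟨ treeProfile-mirror t ⟩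
    treeProfile t                 ≡⟨ profile-word-[] t ⟨
    profile (word t [])           ≡⟨ cong profile P≡ ⟩
    profile P                     ∎
    where open PermutationReasoning

  head-profile-mirrorPath : head (profile (mirrorPath P)) ≡ head (profile P)
  head-profile-mirrorPath = begin
    head (profile (word (mirror t) []))  ≡⟨ cong head (profile-word-[] (mirror t)) ⟩
    head (treeProfile (mirror t))        ≡⟨ head-treeProfile-mirror t ⟩
    head (treeProfile t)                 ≡⟨ cong head (profile-word-[] t) ⟨
    head (profile (word t []))           ≡⟨ cong (head ∘ profile) P≡ ⟩
    head (profile P)                     ∎
    where open ≡-Reasoning

-- Changing the last up-step

profile-replicate-D : ∀ m → profile (replicate m D) ≡ []
profile-replicate-D zero    = refl
profile-replicate-D (suc m) = profile-replicate-D m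

beforeLastUp : List Step → List Step
beforeLastUp []      = []
beforeLastUp (x ∷ P) = if null (profile P) then [] else x ∷ beforeLastUp P

-- Replaces the last up-step, and the down-steps after it, by U c and the down-steps that end the path.
setLastFrom : ℕ → ℕ → List Step → List Step
setLastFrom h c P = W ++ U c ∷ replicate (suc (endHeight h W + c)) D
  where
    W : List Step
    W = beforeLastUp P

setLast : ℕ → List Step → List Step
setLast = setLastFrom 0

beforeLastUp-∷ : ∀ x P → null (profile P) ≡ false → beforeLastUp (x ∷ P) ≡ x ∷ beforeLastUp P
beforeLastUp-∷ x P eq = cong (λ b → if b then [] else x ∷ beforeLastUp P) eq

beforeLastUp-setLast : ∀ W c m → beforeLastUp (W ++ U c ∷ replicate m D) ≡ W
beforeLastUp-setLast []      c m = cong (λ p → if null p then [] else U c ∷ beforeLastUp (replicate m D)) (profile-replicate-D m)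
beforeLastUp-setLast (x ∷ W) c m =
  trans (beforeLastUp-∷ x (W ++ U c ∷ replicate m D) noUp) (cong (x ∷_) (beforeLastUp-setLast W c m))
  where
  noUp : null (profile (W ++ U c ∷ replicate m D)) ≡ false
  noUp = trans (cong null (profile-++ W _)) (null-++-∷ (profile W) c _)

isLuk-replicate-D : ∀ g → T (isLuk g (replicate (suc g) D))
isLuk-replicate-D zero    = tt
isLuk-replicate-D (suc g) = isLuk-replicate-D g

isLuk-downs : ∀ g P → profile P ≡ [] → T (isLuk g P) → P ≡ replicate (suc g) D
isLuk-downs zero    (D ∷ []) _    _   = refl
isLuk-downs (suc g) (D ∷ P)  noUp luk = cong (D ∷_) (isLuk-downs g P noUp luk)

setLastFrom-self : ∀ h P {b} → T (isLuk h P) → last (profile P) ≡ just b → setLastFrom h b P ≡ P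
setLastFrom-self h (U k ∷ P) luk lst with profile P in eq
... | [] with refl ← Maybe.just-injective lst = cong (U k ∷_) (sym (isLuk-downs (h + k) P eq (subst T (isLuk-U h k P) luk)))
... | y ∷ ys = cong (U k ∷_) (setLastFrom-self (h + k) P (subst T (isLuk-U h k P) luk) (trans (cong last eq) lst))
setLastFrom-self zero    (D ∷ [])    luk ()
setLastFrom-self (suc h) (D ∷ P)     luk lst with profile P in eq
... | y ∷ ys = cong (D ∷_) (setLastFrom-self h P luk (trans (cong last eq) lst))

isLuk-setLastFrom : ∀ h P c {b} → T (isLuk h P) → last (profile P) ≡ just b → T (isLuk h (setLastFrom h c P))
isLuk-setLastFrom h (U k ∷ P) c luk lst with profile P in eq
... | [] = subst T (sym (isLuk-U h c _)) (isLuk-replicate-D (h + c))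
... | y ∷ ys = subst T (sym (isLuk-U h k _)) (isLuk-setLastFrom (h + k) P c (subst T (isLuk-U h k P) luk) (trans (cong last eq) lst))
isLuk-setLastFrom zero    (D ∷ [])    c luk ()
isLuk-setLastFrom (suc h) (D ∷ P)     c luk lst with profile P in eq
... | y ∷ ys = isLuk-setLastFrom h P c luk (trans (cong last eq) lst)

setLast-setLast : ∀ c c′ P → setLast c (setLast c′ P) ≡ setLast c P
setLast-setLast c c′ P = cong (λ W → W ++ U c ∷ replicate (suc (endHeight 0 W + c)) D)
  (beforeLastUp-setLast (beforeLastUp P) c′ (suc (endHeight 0 (beforeLastUp P) + c′)))

profile-setLast : ∀ c P → profile (setLast c P) ≡ profile (beforeLastUp P) ∷ʳ c
profile-setLast c P = trans (profile-++ (beforeLastUp P) _)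
  (cong (λ p → profile (beforeLastUp P) ++ c ∷ p) (profile-replicate-D (suc (endHeight 0 (beforeLastUp P) + c))))

areaFrom-replicate-D : ∀ h m → areaFrom h (replicate m D) ≡ 0
areaFrom-replicate-D h zero    = refl
areaFrom-replicate-D h (suc m) = areaFrom-replicate-D (h ∸ 1) m

area-setLast : ∀ c P → area (setLast c P) ≡ areaFrom 0 (beforeLastUp P) + endHeight 0 (beforeLastUp P)
area-setLast c P = begin
  area (W ++ U c ∷ replicate m D)                   ≡⟨ area≡areaFrom (W ++ U c ∷ replicate m D) ⟩
  areaFrom 0 (W ++ U c ∷ replicate m D)             ≡⟨ areaFrom-++ 0 W (U c ∷ replicate m D) ⟩
  areaFrom 0 W + (e + areaFrom (e + c) (replicate m D)) ≡⟨ cong (λ a → areaFrom 0 W + (e + a)) (areaFrom-replicate-D (e + c) m) ⟩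
  areaFrom 0 W + (e + 0)                            ≡⟨ cong (areaFrom 0 W +_) (+-identityʳ e) ⟩
  areaFrom 0 W + e                                  ∎
  where
  open ≡-Reasoning
  W : List Step
  W = beforeLastUp P
  e : ℕ
  e = endHeight 0 W
  m : ℕ
  m = suc (e + c)

mutual
  run-replicate-D : ∀ m st x → run st x (replicate m D) ≡ 0
  run-replicate-D zero    st x = refl
  run-replicate-D (suc m) st x = popRun-replicate-D m st

  popRun-replicate-D : ∀ m st → popRun st (replicate m D) ≡ 0
  popRun-replicate-D m []                 = run-replicate-D m [] 0
  popRun-replicate-D m ((e , zero) ∷ st)  = popRun-replicate-D m st
  popRun-replicate-D m ((e , suc k) ∷ st) = run-replicate-D m _ e

module _ {s s′ : List Step} (same : ∀ st x → run st x s ≡ run st x s′) where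
  mutual
    run-++ʳ : ∀ W st x → run st x (W ++ s) ≡ run st x (W ++ s′)
    run-++ʳ []        st x = same st x
    run-++ʳ (U k ∷ W) st x = cong (x +_) (run-++ʳ W _ x)
    run-++ʳ (D ∷ W)   st x = popRun-++ʳ W st

    popRun-++ʳ : ∀ W st → popRun st (W ++ s) ≡ popRun st (W ++ s′)
    popRun-++ʳ W []                 = run-++ʳ W [] 0
    popRun-++ʳ W ((e , zero) ∷ st)  = popRun-++ʳ W st
    popRun-++ʳ W ((e , suc k) ∷ st) = run-++ʳ W _ e

run-lastUp : ∀ c m st x → run st x (U c ∷ replicate m D) ≡ x
run-lastUp c m st x = trans (cong (x +_) (run-replicate-D m _ x)) (+-identityʳ x)

run-setLast : ∀ c c′ P → run [] 0 (setLast c P) ≡ run [] 0 (setLast c′ P)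
run-setLast c c′ P =
  run-++ʳ (λ st x → trans (run-lastUp c (suc (e + c)) st x) (sym (run-lastUp c′ (suc (e + c′)) st x))) (beforeLastUp P) [] 0
  where
    e : ℕ
    e = endHeight 0 (beforeLastUp P)

-- Membership is witnessed by a Boolean, so a path determines its element.
record Paths {Q : List Step → Set} (Q? : Decidable Q) : Set where
  constructor _⟨_⟩
  field
    path   : List Step
    inside : True (Q? path)

  valid : Q path
  valid = toWitness inside

open Paths public using (path; valid)

mkPath : ∀ {Q : List Step → Set} {Q? : Decidable Q} P → Q P → Paths Q?
mkPath P q = P ⟨ fromWitness q ⟩

Paths-≡ : ∀ {Q : List Step → Set} {Q? : Decidable Q} {x y : Paths Q?} → path x ≡ path y → x ≡ y
Paths-≡ {x = P ⟨ t ⟩} {.P ⟨ t′ ⟩} refl = cong (P ⟨_⟩) (T-irrelevant t t′)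

module _ {Q : List Step → Set} {Q? : Decidable Q} where

  module _ {Q′ : List Step → Set} {Q′? : Decidable Q′} where

    Paths-↔ : (f g : List Step → List Step) → (∀ {P} → Q P → Q′ (f P)) → (∀ {P} → Q′ P → Q (g P)) →
              (∀ {P} → Q P → g (f P) ≡ P) → (∀ {P} → Q′ P → f (g P) ≡ P) → Paths Q? ↔ Paths Q′?
    Paths-↔ f g fQ gQ gf fg = mk↔ₛ′
      (λ x → mkPath (f (path x)) (fQ (valid x)))
      (λ y → mkPath (g (path y)) (gQ (valid y)))
      (λ y → Paths-≡ (fg (valid y)))
      (λ x → Paths-≡ (gf (valid x)))

    Paths-cong : (∀ {P} → Q P → Q′ P) → (∀ {P} → Q′ P → Q P) → Paths Q? ↔ Paths Q′?
    Paths-cong QQ′ Q′Q = Paths-↔ id id QQ′ Q′Q (λ _ → refl) (λ _ → refl)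

  module _ {R : List Step → Set} (R? : Decidable R) where

    private
      Yes No : Set
      Yes = Paths (λ P → Q? P ×-dec R? P)
      No  = Paths (λ P → Q? P ×-dec ¬? (R? P))

      classify : ∀ P → Q P → Dec (R P) → Yes ⊎ No
      classify P q (yes r) = inj₁ (mkPath P (q , r))
      classify P q (no ¬r) = inj₂ (mkPath P (q , ¬r))

      forget : Yes ⊎ No → Paths Q?
      forget (inj₁ y) = mkPath (path y) (proj₁ (valid y))
      forget (inj₂ n) = mkPath (path n) (proj₁ (valid n))

      forget-classify : ∀ x (d : Dec (R (path x))) → forget (classify (path x) (valid x) d) ≡ x
      forget-classify x (yes r) = Paths-≡ refl
      forget-classify x (no ¬r) = Paths-≡ refl

      classify-forget : ∀ z (d : Dec (R (path (forget z)))) → classify _ (valid (forget z)) d ≡ z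
      classify-forget (inj₁ y) (yes r) = cong inj₁ (Paths-≡ refl)
      classify-forget (inj₁ y) (no ¬r) = ⊥-elim (¬r (proj₂ (valid y)))
      classify-forget (inj₂ n) (yes r) = ⊥-elim (proj₂ (valid n) r)
      classify-forget (inj₂ n) (no ¬r) = cong inj₂ (Paths-≡ refl)

    splitBy : Paths Q? ↔ (Paths (λ P → Q? P ×-dec R? P) ⊎ Paths (λ P → Q? P ×-dec ¬? (R? P)))
    splitBy = mk↔ₛ′ (λ x → classify (path x) (valid x) (R? (path x))) forget
                    (λ z → classify-forget z (R? (path (forget z)))) (λ x → forget-classify x (R? (path x)))

  module _ {B : Set} (_≟B_ : DecidableEquality B) (ℓ : List Step → B) where

    private
      Fibre : B → Set
      Fibre b = Paths (λ P → Q? P ×-dec (ℓ P ≟B b))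

      fibre-≡ : ∀ {b} (y : Fibre b) (e : ℓ (path y) ≡ b) q →
                _≡_ {A = Σ B Fibre} (ℓ (path y) , mkPath (path y) (q , refl)) (b , y)
      fibre-≡ (P ⟨ t ⟩) refl q = cong (_ ,_) (Paths-≡ refl)

    fibres : Paths Q? ↔ Σ B Fibre
    fibres = mk↔ₛ′
      (λ x → ℓ (path x) , mkPath (path x) (valid x , refl))
      (λ (b , y) → mkPath (path y) (proj₁ (valid y)))
      (λ (b , y) → fibre-≡ y (proj₂ (valid y)) _)
      (λ x → Paths-≡ refl)

Finite : Set → Set
Finite A = Σ ℕ (λ n → A ↔ Fin n)

finite-⊎ : ∀ {A B : Set} → Finite A → Finite B → Finite (A ⊎ B)
finite-⊎ (m , A↔) (n , B↔) = m + n , ↔-trans (A↔ ⊎-↔ B↔) (↔-sym +↔⊎)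

finite-↔ : ∀ {A B : Set} → A ↔ B → Finite B → Finite A
finite-↔ A↔B (n , B↔) = n , ↔-trans A↔B B↔

_≟ₛ_ : DecidableEquality Step
D   ≟ₛ D   = yes refl
D   ≟ₛ U _ = no λ ()
U _ ≟ₛ D   = no λ ()
U k ≟ₛ U l with k ≟ l
... | yes refl = yes refl
... | no k≢l   = no λ { refl → k≢l refl }

_≟ₚ_ : DecidableEquality (List Step)
_≟ₚ_ = List.≡-dec _≟ₛ_

module _ {Q : List Step → Set} (Q? : Decidable Q) where

  finite-singleton : ∀ e → Finite (Paths (λ P → Q? P ×-dec (P ≟ₚ e)))
  finite-singleton e with Q? e
  ... | yes q = 1 , mk↔ₛ′ (λ _ → zero) (λ _ → mkPath e (q , refl)) (λ { zero → refl })
                          (λ x → Paths-≡ (sym (proj₂ (valid x))))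
  ... | no ¬q = 0 , mk↔ₛ′ (⊥-elim ∘ absent) (λ ()) (λ ()) (⊥-elim ∘ absent)
    where
    absent : Paths (λ P → Q? P ×-dec (P ≟ₚ e)) → ⊥
    absent x = ¬q (subst Q (proj₂ (valid x)) (proj₁ (valid x)))

finite-cover : ∀ {Q : List Step → Set} (Q? : Decidable Q) (E : List (List Step)) → (∀ {P} → Q P → P ∈ E) →
               Finite (Paths Q?)
finite-cover Q? []      cover = 0 , mk↔ₛ′ (⊥-elim ∘ absent) (λ ()) (λ ()) (⊥-elim ∘ absent)
  where
  absent : Paths Q? → ⊥
  absent x with () ← cover (valid x)
finite-cover {Q} Q? (e ∷ E) cover =
  finite-↔ (splitBy (λ P → P ≟ₚ e)) (finite-⊎ (finite-singleton Q? e) (finite-cover _ E cover′))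
  where
  cover′ : ∀ {P} → Q P × ¬ P ≡ e → P ∈ E
  cover′ (q , P≢e) with cover q
  ... | here P≡e = ⊥-elim (P≢e P≡e)
  ... | there P∈E = P∈E

cancel : ∀ {A A′ L L′ R R′ : Set} → Finite L → Finite L′ → Finite R →
         A ↔ (L ⊎ R) → A′ ↔ (L′ ⊎ R′) → A ↔ A′ → R ↔ R′ → L ↔ L′
cancel (l , L↔) (l′ , L′↔) (r , R↔) A↔ A′↔ A↔A′ R↔R′ =
  ↔-trans L↔ (↔-trans (subst (λ n → Fin l ↔ Fin n) l≡l′ ↔-refl) (↔-sym L′↔))
  where
  sizes : Fin (l + r) ↔ Fin (l′ + r)
  sizes = ↔-trans +↔⊎ (↔-trans (↔-sym (L↔ ⊎-↔ R↔)) (↔-trans (↔-sym A↔) (↔-trans A↔A′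
            (↔-trans A′↔ (↔-trans (L′↔ ⊎-↔ ↔-trans (↔-sym R↔R′) R↔) (↔-sym +↔⊎))))))
  l≡l′ : l ≡ l′
  l≡l′ = +-cancelʳ-≡ r l l′ (↔⇒≡ sizes)

steps : ℕ → List Step
steps K = D ∷ map U (upTo (suc K))

stepLists : ℕ → ℕ → List (List Step)
stepLists K zero    = [ [] ]
stepLists K (suc n) = cartesianProductWith _∷_ (steps K) (stepLists K n)

∈-stepLists : ∀ K P → All (_≤ K) (profile P) → P ∈ stepLists K (length P)
∈-stepLists K []        []          = here refl
∈-stepLists K (D ∷ P)   ks          = ∈-cartesianProductWith⁺ _∷_ {xs = steps K} (here refl) (∈-stepLists K P ks)
∈-stepLists K (U k ∷ P) (k≤K ∷ ks)  = ∈-cartesianProductWith⁺ _∷_ (there (∈-map⁺ U (∈-upTo⁺ (s≤s k≤K)))) (∈-stepLists K P ks)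

length-isLuk : ∀ h P → T (isLuk h P) → length P ≡ length (profile P) + suc (h + sum (profile P))
length-isLuk h       (U k ∷ P) luk = begin
  suc (length P)                                               ≡⟨ cong suc (length-isLuk (h + k) P (subst T (isLuk-U h k P) luk)) ⟩
  suc (length (profile P) + suc (h + k + sum (profile P)))     ≡⟨ cong (λ n → suc (length (profile P) + suc n)) (+-assoc h k _) ⟩
  suc (length (profile P) + suc (h + (k + sum (profile P))))   ∎
  where open ≡-Reasoning
length-isLuk zero    (D ∷ [])  luk = refl
length-isLuk (suc h) (D ∷ P)   luk = trans (cong suc (length-isLuk h P luk)) (sym (+-suc _ _))

∈-stepLists-isLuk : ∀ {P N} → T (isLuk 0 P) → profile P ↭ N → P ∈ stepLists (sum N) (length N + suc (sum N))
∈-stepLists-isLuk {P} {N} luk p↭N = subst₂ (λ K n → P ∈ stepLists K n) (sum-↭ p↭N) len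
  (∈-stepLists (sum (profile P)) P (≤-sum (profile P)))
  where
  len : length P ≡ length N + suc (sum N)
  len = trans (length-isLuk 0 P luk) (cong₂ (λ l s → l + suc s) (↭.↭-length p↭N) (sum-↭ p↭N))

-- Symmetry

_≟ₘ_ : DecidableEquality (Maybe ℕ)
_≟ₘ_ = Maybe.≡-dec _≟_

_≟ₗ_ : DecidableEquality (List ℕ)
_≟ₗ_ = List.≡-dec _≟_

record InA (a : ℕ) (S : List ℕ) (i j : ℕ) (P : List Step) : Set where
  constructor inA
  field
    luk    : T (isLuk 0 P)
    first  : head (profile P) ≡ just a
    sorted : sort (profile P) ≡ S
    area≡  : area P ≡ i
    depth≡ : depth P ≡ j

inA? : ∀ a S i j → Decidable (InA a S i j)
inA? a S i j P = map′ (λ (l , f , s , ar , dp) → inA l f s ar dp) (λ (inA l f s ar dp) → l , f , s , ar , dp)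
  (T? (isLuk 0 P) ×-dec head (profile P) ≟ₘ just a ×-dec sort (profile P) ≟ₗ S ×-dec area P ≟ i ×-dec depth P ≟ j)

lastIs? : ∀ b → Decidable (λ P → last (profile P) ≡ just b)
lastIs? b P = last (profile P) ≟ₘ just b

-- 𝓛 a (sort (a ∷ b ∷ M)) b i j consists of the paths of 𝓛_{a,M,b} with area i and depth j;
-- 𝓐 drops the condition on the last up-step.
𝓐 : ℕ → List ℕ → ℕ → ℕ → Set
𝓐 a S i j = Paths (inA? a S i j)

𝓛 : ℕ → List ℕ → ℕ → ℕ → ℕ → Set
𝓛 a S b i j = Paths (λ P → inA? a S i j P ×-dec lastIs? b P)

InLcoef-irrelevant : ∀ {a M b i j P} (x y : InL a M b P × area P ≡ i × depth P ≡ j) → x ≡ y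
InLcoef-irrelevant ((luk , first , final , sorted) , ar , dp) ((luk′ , first′ , final′ , sorted′) , ar′ , dp′) =
  cong₂ _,_ (cong₂ _,_ (T-irrelevant luk luk′)
                       (cong₂ _,_ (uipₘ first first′) (cong₂ _,_ (uipₘ final final′) (uipₗ sorted sorted′))))
            (cong₂ _,_ (≡-irrelevant ar ar′) (≡-irrelevant dp dp′))
  where
  uipₘ : UIP.UIP (Maybe ℕ)
  uipₘ = UIP.Decidable⇒UIP.≡-irrelevant _≟ₘ_
  uipₗ : UIP.UIP (List ℕ)
  uipₗ = UIP.Decidable⇒UIP.≡-irrelevant _≟ₗ_

Lcoef↔𝓛 : ∀ a M b i j → Lcoef a M b i j ↔ 𝓛 a (sort (a ∷ b ∷ M)) b i j
Lcoef↔𝓛 a M b i j = mk↔ₛ′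
  (λ (P , (luk , first , final , sorted) , ar , dp) → mkPath P (inA luk first sorted ar dp , final))
  (λ x → path x , reorder (valid x))
  (λ _ → Paths-≡ refl)
  (λ (P , _) → cong (P ,_) (InLcoef-irrelevant {a} {M} {b} {i} {j} {P} _ _))
  where
  reorder : ∀ {P} → InA a (sort (a ∷ b ∷ M)) i j P × last (profile P) ≡ just b → InL a M b P × area P ≡ i × depth P ≡ j
  reorder (inA luk first sorted ar dp , final) = (luk , first , final , sorted) , ar , dp

𝓐-mirror : ∀ a S i j → 𝓐 a S i j ↔ 𝓐 a S j i
𝓐-mirror a S i j = Paths-↔ mirrorPath mirrorPath mirrored mirrored
  (λ q → mirrorPath-involutive (InA.luk q)) (λ q → mirrorPath-involutive (InA.luk q))
  where
  mirrored : ∀ {i j P} → InA a S i j P → InA a S j i (mirrorPath P)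
  mirrored {P = P} (inA luk first sorted ar dp) = inA (isLuk-mirrorPath P) (trans (head-profile-mirrorPath {P} luk) first)
    (trans (↭⇒sort≡ (profile-mirrorPath {P} luk)) sorted) (trans (area-mirrorPath {P} luk) dp) (trans (depth-mirrorPath {P} luk) ar)

module _ {a M i j b P} (q : InA a (sort (a ∷ b ∷ M)) i j P × last (profile P) ≡ just b) where

  private
    open InA (proj₁ q)
    final : last (profile P) ≡ just b
    final = proj₂ q
    W : List Step
    W = beforeLastUp P
    P≡ : setLast b P ≡ P
    P≡ = setLastFrom-self 0 P luk final
    profileP : profile P ≡ profile W ∷ʳ b
    profileP = trans (cong profile (sym P≡)) (profile-setLast b P)
    profileW : profile W ↭ a ∷ M
    profileW = ∷ʳ-↭-cancel (subst (_↭ a ∷ b ∷ M) profileP (sort≡⇒↭ sorted))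

  setLast-InA : ∀ c → InA a (sort (a ∷ c ∷ M)) i j (setLast c P) × last (profile (setLast c P)) ≡ just c
  setLast-InA c =
    inA luk′ first′ (↭⇒sort≡ (subst (_↭ a ∷ c ∷ M) (sym (profile-setLast c P)) (∷ʳ-↭ c profileW)))
        (trans (area-setLast c P) (trans (sym (area-setLast b P)) (trans (cong area P≡) area≡)))
        depth′ ,
    trans (cong last (profile-setLast c P)) (last-∷ʳ (profile W) c)
    where
    luk′ : T (isLuk 0 (setLast c P))
    luk′ = isLuk-setLastFrom 0 P c luk final
    first′ : head (profile (setLast c P)) ≡ just a
    first′ = begin
      head (profile (setLast c P))  ≡⟨ cong head (profile-setLast c P) ⟩
      head (profile W ∷ʳ c)         ≡⟨ head-∷ʳ (profile W) c b (λ W≡[] → 0≢1+n (trans (cong length (sym W≡[]))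
                                                                                       (↭.↭-length profileW))) ⟩
      head (profile W ∷ʳ b)         ≡⟨ cong head profileP ⟨
      head (profile P)              ≡⟨ first ⟩
      just a                        ∎
      where open ≡-Reasoning
    depth′ : depth (setLast c P) ≡ j
    depth′ = begin
      depth (setLast c P)    ≡⟨ depth≡run (setLast c P) luk′ ⟩
      run [] 0 (setLast c P) ≡⟨ run-setLast c b P ⟩
      run [] 0 (setLast b P) ≡⟨ cong (run [] 0) P≡ ⟩
      run [] 0 P             ≡⟨ depth≡run P luk ⟨
      depth P                ≡⟨ depth≡ ⟩
      j                      ∎
      where open ≡-Reasoning

  setLast-inverse : ∀ c → setLast b (setLast c P) ≡ P
  setLast-inverse c = trans (setLast-setLast b c P) P≡

𝓛-setLast : ∀ a M b c i j → 𝓛 a (sort (a ∷ b ∷ M)) b i j ↔ 𝓛 a (sort (a ∷ c ∷ M)) c i j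
𝓛-setLast a M b c i j = Paths-↔ (setLast c) (setLast b)
  (λ {P} q → setLast-InA {a} {M} {i} {j} {b} {P} q c) (λ {P} q → setLast-InA {a} {M} {i} {j} {c} {P} q b)
  (λ {P} q → setLast-inverse {a} {M} {i} {j} {b} {P} q c) (λ {P} q → setLast-inverse {a} {M} {i} {j} {c} {P} q b)

finite-InA : ∀ {a S i j} {Q : List Step → Set} (Q? : Decidable Q) → (∀ {P} → Q P → InA a S i j P) → Finite (Paths Q?)
finite-InA {S = S} {Q = Q} Q? inA′ = finite-cover Q? (stepLists (sum S) (length S + suc (sum S))) cover
  where
  cover : ∀ {P} → Q P → P ∈ stepLists (sum S) (length S + suc (sum S))
  cover {P} q = ∈-stepLists-isLuk luk (subst (profile P ↭_) sorted (↭-sym (sort-↭ (profile P))))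
    where open InA (inA′ q)

Symmetric : ℕ → List ℕ → Set
Symmetric a M = ∀ i j → 𝓛 a (sort (a ∷ 0 ∷ M)) 0 i j ↔ 𝓛 a (sort (a ∷ 0 ∷ M)) 0 j i

module _ (a : ℕ) (M : List ℕ) (IH : ∀ {M′} → sum M′ < sum M → Symmetric a M′) where

  private
    S : List ℕ
    S = sort (a ∷ 0 ∷ M)

    notLast0? : ∀ i j → Decidable (λ P → InA a S i j P × ¬ last (profile P) ≡ just 0)
    notLast0? i j P = inA? a S i j P ×-dec ¬? (lastIs? 0 P)

    Fibre : ℕ → ℕ → Maybe ℕ → Set
    Fibre i j m = Paths (λ P → notLast0? i j P ×-dec last (profile P) ≟ₘ m)

    empty-fibre : ∀ {m} → (∀ {i j P} → InA a S i j P → last (profile P) ≢ just 0 → last (profile P) ≢ m) →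
                  ∀ i j → Fibre i j m ↔ Fibre j i m
    empty-fibre none i j =
      Paths-cong (λ ((q , ≢0) , eq) → ⊥-elim (none q ≢0 eq)) (λ ((q , ≢0) , eq) → ⊥-elim (none q ≢0 eq))

    module _ {b} (b∈M : suc b ∈ M) where

      ys zs M′ : List ℕ
      ys = proj₁ (∈-∃++ b∈M)
      zs = proj₁ (proj₂ (∈-∃++ b∈M))
      M′ = ys ++ zs

      M≡ : M ≡ ys ++ suc b ∷ zs
      M≡ = proj₂ (proj₂ (∈-∃++ b∈M))

      smaller : sum (0 ∷ M′) < sum M
      smaller = begin-strict
        sum (ys ++ zs)              ≡⟨ sum-++ ys zs ⟩
        sum ys + sum zs             <⟨ +-monoʳ-< (sum ys) (m<n+m (sum zs) z<s) ⟩
        sum ys + (suc b + sum zs)   ≡⟨ sum-++ ys (suc b ∷ zs) ⟨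
        sum (ys ++ suc b ∷ zs)      ≡⟨ cong sum M≡ ⟨
        sum M                       ∎
        where open ≤-Reasoning

      S≡ : S ≡ sort (a ∷ suc b ∷ 0 ∷ M′)
      S≡ = ↭⇒sort≡ (prep a (↭-trans (prep 0 (subst (_↭ suc b ∷ M′) (sym M≡) (↭.shift (suc b) ys zs)))
                                    (swap 0 (suc b) ↭-refl)))

      toBase : ∀ i j → Fibre i j (just (suc b)) ↔ 𝓛 a (sort (a ∷ 0 ∷ 0 ∷ M′)) 0 i j
      toBase i j = ↔-trans
        (Paths-cong (λ ((q , _) , eq) → subst (λ S → InA a S i j _) S≡ q , eq)
                    (λ (q , eq) → (subst (λ S → InA a S i j _) (sym S≡) q ,
                                   λ eq0 → 1+n≢0 (Maybe.just-injective (trans (sym eq) eq0))) , eq))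
        (𝓛-setLast a (0 ∷ M′) (suc b) 0 i j)

    fibre-sym : ∀ i j m → Fibre i j m ↔ Fibre j i m
    fibre-sym i j nothing = empty-fibre (λ q _ → head⇒last (InA.first q)) i j
    fibre-sym i j (just zero) = empty-fibre (λ _ ≢0 → ≢0) i j
    fibre-sym i j (just (suc b)) with suc b ∈? M
    ... | yes b∈M = ↔-trans (toBase b∈M i j) (↔-trans (IH (smaller b∈M) i j) (↔-sym (toBase b∈M j i)))
    ... | no  b∉M = empty-fibre notInM i j
      where
      notInM : ∀ {i j P} → InA a S i j P → last (profile P) ≢ just 0 → last (profile P) ≢ just (suc b)
      notInM q _ eq with last-∈-tail (InA.first q) (sort≡⇒↭ (InA.sorted q)) eq
      ... | there b∈M = b∉M b∈M

    rest-sym : ∀ i j → Paths (notLast0? i j) ↔ Paths (notLast0? j i)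
    rest-sym i j = ↔-trans (fibres _≟ₘ_ (last ∘ profile))
                  (↔-trans (Σ-↔ ↔-refl (fibre-sym i j _)) (↔-sym (fibres _≟ₘ_ (last ∘ profile))))

  symmetric-step : Symmetric a M
  symmetric-step i j = cancel (finite-InA _ proj₁) (finite-InA _ proj₁) (finite-InA _ proj₁)
    (splitBy (lastIs? 0)) (splitBy (lastIs? 0)) (𝓐-mirror a S i j) (rest-sym i j)

symmetric : ∀ a M → Symmetric a M
symmetric a = WF.All.wfRec (On.wellFounded sum <-wellFounded) _ (Symmetric a) (λ M IH → symmetric-step a M IH)

theorem1p1 : (a b : ℕ) (M : List ℕ) (i j : ℕ) →
    Lcoef a M b i j ↔ Lcoef a M b j i
theorem1p1 a b M i j = begin
  Lcoef a M b i j                    ↔⟨ Lcoef↔𝓛 a M b i j ⟩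
  𝓛 a (sort (a ∷ b ∷ M)) b i j       ↔⟨ 𝓛-setLast a M b 0 i j ⟩
  𝓛 a (sort (a ∷ 0 ∷ M)) 0 i j       ↔⟨ symmetric a M i j ⟩
  𝓛 a (sort (a ∷ 0 ∷ M)) 0 j i       ↔⟨ 𝓛-setLast a M 0 b j i ⟩
  𝓛 a (sort (a ∷ b ∷ M)) b j i       ↔⟨ Lcoef↔𝓛 a M b j i ⟨
  Lcoef a M b j i                    ∎
  where open EquationalReasoning {k = bijection}
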